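{- For every positive integer $n$, the numbers $o_E(\Lambda_n,n)$ and $o_E(\Lambda_n,2n)$ of edge orbits of $\Lambda_n$ of sizes $n$ and $2n$ satisfy \[ o_E(\Lambda_n, n) = F_{\lfloor \frac{n+1+(-1)^n}{2}\rfloor},\qquad o_E(\Lambda_n, 2n) = \frac{1}{2}\left(F_{n-1} - F_{\lfloor \frac{n+1+(-1)^n}{2}\rfloor}\right). \]
   Context: A Lucas string of length $n$ is a binary string $u_1\cdots u_n$ with no two consecutive 1s and not both $u_1=1$ and $u_n=1$. The Lucas cube $\Lambda_n$ is the subgraph of the $n$-cube $Q_n$ (binary strings of length $n$, adjacent iff they differ in exactly one position) induced by the Lucas strings of length $n$. $o_E(\Lambda_n,k)$ is the number of orbits of size $k$ of ${\rm Aut}(\Lambda_n)$ acting on $E(\Lambda_n)$ via $\{u,v\}\mapsto\{g(u),g(v)\}$. $F_m$ are Fibonacci numbers with $F_0=0$, $F_1=1$. -}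

module Defs where

open import Data.Nat using (ℕ; zero; suc; _+_; _*_; _∸_; _/_)
open import Data.Bool using (Bool; true; false; not; _∧_; _xor_; T)
open import Data.Vec using (Vec; []; _∷_)
open import Data.Fin using (Fin)
open import Data.Product using (Σ; Σ-syntax; ∃; _×_; _,_; proj₁; proj₂)
open import Data.Sum using (_⊎_)
open import Function.Bundles using (_↔_; Inverse; _⇔_)
open import Relation.Binary.PropositionalEquality using (_≡_)

F : ℕ → ℕ
F zero = zero
F (suc zero) = suc zero
F (suc (suc n)) = F (suc n) + F n

lastB : ∀ {n} → Vec Bool (suc n) → Bool
lastB (x ∷ []) = x
lastB (x ∷ y ∷ xs) = lastB (y ∷ xs)

noConsec : ∀ {n} → Vec Bool n → Bool
noConsec [] = true
noConsec (x ∷ []) = true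
noConsec (x ∷ y ∷ xs) = not (x ∧ y) ∧ noConsec (y ∷ xs)

isLucas : ∀ {n} → Vec Bool n → Bool
isLucas [] = true
isLucas (x ∷ xs) = noConsec (x ∷ xs) ∧ not (x ∧ lastB (x ∷ xs))

hamming : ∀ {n} → Vec Bool n → Vec Bool n → ℕ
hamming [] [] = zero
hamming (x ∷ xs) (y ∷ ys) = (if x xor y then 1 else 0) + hamming xs ys
  where open import Data.Bool using (if_then_else_)

V : ℕ → Set
V n = Σ (Vec Bool n) (λ u → T (isLucas u))

Adj : ∀ {n} → V n → V n → Set
Adj u v = hamming (proj₁ u) (proj₁ v) ≡ 1

record Aut (n : ℕ) : Set where
  field
    perm     : V n ↔ V n
    preserve : ∀ u v → Adj u v ⇔ Adj (Inverse.to perm u) (Inverse.to perm v)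

act : ∀ {n} → Aut n → V n → V n
act g = Inverse.to (Aut.perm g)

-- (undirected) edges of Λ_n, given by an adjacent pair of endpoints
Edge : ℕ → Set
Edge n = Σ (V n × V n) (λ p → Adj (proj₁ p) (proj₂ p))

SamePair : ∀ {n} → V n × V n → V n × V n → Set
SamePair (u , v) (u' , v') = (u ≡ u' × v ≡ v') ⊎ (u ≡ v' × v ≡ u')

_≈E_ : ∀ {n} → Edge n → Edge n → Set
e ≈E e' = SamePair (proj₁ e) (proj₁ e')

InOrbit : ∀ {n} → Edge n → Edge n → Set
InOrbit {n} ((u , v) , _) e' = Σ (Aut n) λ g → SamePair (act g u , act g v) (proj₁ e')

OrbitSize : ∀ {n} → Edge n → ℕ → Set
OrbitSize {n} e k =
  Σ (Fin k → Edge n) λ f →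
    (∀ i j → f i ≈E f j → i ≡ j) ×
    (∀ i → InOrbit e (f i)) ×
    (∀ e' → InOrbit e e' → ∃ λ i → f i ≈E e')

-- o_E(Λ_n, k) = m : there are exactly m orbits of size k, i.e. a family of
-- m representatives of orbits of size k, lying in pairwise distinct orbits,
-- and meeting every orbit of size k
NumEdgeOrbitsOfSize : (n k m : ℕ) → Set
NumEdgeOrbitsOfSize n k m =
  Σ (Fin m → Edge n) λ r →
    (∀ i → OrbitSize (r i) k) ×
    (∀ i j → InOrbit (r i) (r j) → i ≡ j) ×
    (∀ e → OrbitSize e k → ∃ λ i → InOrbit (r i) e)

-- 1 + (-1)^n
onePlusSign : ℕ → ℕ
onePlusSign zero = 2
onePlusSign (suc zero) = 0
onePlusSign (suc (suc n)) = onePlusSign n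

idx : ℕ → ℕ
idx n = (n + onePlusSign n) / 2

module Submission where

-- Write n = N + 1 and read strings u₀ ⋯ u_N cyclically (positions mod n).
-- Lucas strings are the cyclic strings without two cyclically consecutive
-- ones, and vertices of Λₙ are adjacent iff they differ in one position.
--  1. Automorphisms (n ≥ 2).  The dihedral maps u ↦ (i ↦ u(a + c·i)),
--     c ≡ ±1, are automorphisms, and there are no others: an automorphism
--     fixes the zero string and maps each unit e_j to a unit e_σ(j) with
--     σ(j+1) ≡ σ(j) ± 1, so σ is affine; composed with a dihedral map it then
--     fixes zero and all units, hence every vertex (induction on weight).
--  2. Orbits.  Every edge lies in the orbit of a rooted edge {w - e₀, w}
--     (w₀ = 1); the rooted edges of w and w' share an orbit iff w' is w or
--     its mirror image, and the orbit has n elements if w is mirror-symmetric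
--     and 2n elements otherwise.
--  3. Counting (n = m + 3).  The rooted strings are 1 0 s 0 with s a
--     Fibonacci string of length m, and mirroring reverses s.  Palindromic
--     Fibonacci strings number F(idx n); the others pair up under reversal,
--     leaving (F(n-1) - F(idx n))/2 classes.

open import Defs
open import Data.Nat
open import Data.Nat.Properties
open import Data.Nat.DivMod
open import Data.Nat.Tactic.RingSolver using (solve-∀)
open import Data.Fin as Fin using (Fin; toℕ; fromℕ<; splitAt; join)
import Data.Fin.Properties as FinP
open import Data.Bool using (Bool; true; false; not; _∧_; _xor_; T; if_then_else_)
import Data.Bool.Properties as BoolP
open import Data.Unit using (tt)
open import Data.Vec using (Vec; []; _∷_; _∷ʳ_; lookup; tabulate; replicate; reverse; initLast)
import Data.Vec.Properties as VecP
open import Data.List as List using (List; []; _∷_; length; filter; map; _++_)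
open import Data.List.Relation.Unary.Any as Any using (here; there)
import Data.List.Relation.Unary.All as All
open import Data.List.Relation.Unary.AllPairs using ([]; _∷_)
open import Data.List.Relation.Unary.Unique.Propositional using (Unique)
import Data.List.Relation.Unary.Unique.Propositional.Properties as UniqueP
open import Data.List.Membership.Propositional using (_∈_)
open import Data.List.Membership.Propositional.Properties
  using (∈-lookup; ∈-map⁺; ∈-map⁻; ∈-++⁺ˡ; ∈-++⁺ʳ; ∈-++⁻; ∈-filter⁺; ∈-filter⁻)
open import Data.List.Relation.Unary.Any.Properties using (lookup-index)
import Data.List.Properties as ListP
open import Data.Product using (Σ; ∃; _×_; _,_; proj₁; proj₂)
open import Data.Sum using (_⊎_; inj₁; inj₂)
open import Data.Empty using (⊥; ⊥-elim)
open import Function.Base using (_∘_)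
open import Function.Bundles using (Inverse; Equivalence; mk↔ₛ′; mk⇔)
open import Relation.Nullary using (¬_; Dec; yes; no; ¬?)
open import Relation.Nullary.Decidable using (⌊_⌋)
open import Relation.Unary using (Pred; Decidable)
open import Relation.Binary.PropositionalEquality
open import Relation.Binary.Bundles using (Setoid)
import Relation.Binary.Reasoning.Setoid as SetoidReasoning


-- Letters of a string indexed by ℕ, reading `false` past the end; this lets
-- positions be handled without Fin arithmetic.
bit : ∀ {m} → Vec Bool m → ℕ → Bool
bit [] _ = false
bit (x ∷ xs) zero = x
bit (x ∷ xs) (suc k) = bit xs k

bit-outside : ∀ {m} (v : Vec Bool m) k → m ≤ k → bit v k ≡ false
bit-outside [] k _ = refl
bit-outside (x ∷ v) (suc k) (s≤s m≤k) = bit-outside v k m≤k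

lookup≡bit : ∀ {m} (v : Vec Bool m) (i : Fin m) → lookup v i ≡ bit v (toℕ i)
lookup≡bit (x ∷ v) Fin.zero = refl
lookup≡bit (x ∷ v) (Fin.suc i) = lookup≡bit v i

bit-ext : ∀ {m} (u v : Vec Bool m) → (∀ j → bit u j ≡ bit v j) → u ≡ v
bit-ext [] [] _ = refl
bit-ext (x ∷ u) (y ∷ v) h = cong₂ _∷_ (h 0) (bit-ext u v (λ j → h (suc j)))

lastB≡bit : ∀ {m} (v : Vec Bool (suc m)) → lastB v ≡ bit v m
lastB≡bit (x ∷ []) = refl
lastB≡bit (x ∷ y ∷ v) = lastB≡bit (y ∷ v)

NoAdjacentOnes : ∀ {m} → Vec Bool m → Set
NoAdjacentOnes v = ∀ k → bit v k ∧ bit v (suc k) ≡ false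

noConsec⇒ : ∀ {m} (v : Vec Bool m) → T (noConsec v) → NoAdjacentOnes v
noConsec⇒ [] _ k = refl
noConsec⇒ (x ∷ []) _ zero = BoolP.∧-zeroʳ x
noConsec⇒ (x ∷ []) _ (suc k) = refl
noConsec⇒ (x ∷ y ∷ v) t zero =
  Equivalence.to BoolP.T-not-≡ (proj₁ (Equivalence.to (BoolP.T-∧ {not (x ∧ y)}) t))
noConsec⇒ (x ∷ y ∷ v) t (suc k) =
  noConsec⇒ (y ∷ v) (proj₂ (Equivalence.to (BoolP.T-∧ {not (x ∧ y)}) t)) k

⇒noConsec : ∀ {m} (v : Vec Bool m) → NoAdjacentOnes v → T (noConsec v)
⇒noConsec [] _ = tt
⇒noConsec (x ∷ []) _ = tt
⇒noConsec (x ∷ y ∷ v) h =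
  Equivalence.from BoolP.T-∧ (Equivalence.from BoolP.T-not-≡ (h 0) , ⇒noConsec (y ∷ v) (λ k → h (suc k)))

LucasLetters : ∀ {m} → Vec Bool (suc m) → Set
LucasLetters {m} v = NoAdjacentOnes v × bit v 0 ∧ bit v m ≡ false

isLucas⇒ : ∀ {m} (v : Vec Bool (suc m)) → T (isLucas v) → LucasLetters v
isLucas⇒ (x ∷ v) t =
  noConsec⇒ (x ∷ v) (proj₁ parts) ,
  trans (cong (x ∧_) (sym (lastB≡bit (x ∷ v)))) (Equivalence.to BoolP.T-not-≡ (proj₂ parts))
  where parts = Equivalence.to (BoolP.T-∧ {noConsec (x ∷ v)}) t

⇒isLucas : ∀ {m} (v : Vec Bool (suc m)) → LucasLetters v → T (isLucas v)
⇒isLucas (x ∷ v) (noAdj , ends) =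
  Equivalence.from BoolP.T-∧
    (⇒noConsec (x ∷ v) noAdj , Equivalence.from BoolP.T-not-≡ (trans (cong (x ∧_) (lastB≡bit (x ∷ v))) ends))

FlipAt : ∀ {m} → Vec Bool m → Vec Bool m → ℕ → Set
FlipAt {m} u v k = k < m × bit v k ≡ not (bit u k) × (∀ j → j ≢ k → bit v j ≡ bit u j)

flip-head : ∀ {m} x (u : Vec Bool m) → FlipAt (x ∷ u) (not x ∷ u) 0
flip-head x u = s≤s z≤n , refl , λ { zero 0≢0 → ⊥-elim (0≢0 refl) ; (suc j) _ → refl }

flip-tail : ∀ {m} x {u v : Vec Bool m} {k} → FlipAt u v k → FlipAt (x ∷ u) (x ∷ v) (suc k)
flip-tail x (k<m , flipped , rest) =
  s≤s k<m , flipped , λ { zero _ → refl ; (suc j) j≢k → rest j (λ j≡k → j≢k (cong suc j≡k)) }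

same-letter : ∀ x → (if x xor x then 1 else 0) ≡ 0
same-letter true = refl
same-letter false = refl

hamming-self : ∀ {m} (u : Vec Bool m) → hamming u u ≡ 0
hamming-self [] = refl
hamming-self (x ∷ u) = trans (cong (_+ hamming u u) (same-letter x)) (hamming-self u)

hamming≡0 : ∀ {m} (u v : Vec Bool m) → hamming u v ≡ 0 → u ≡ v
hamming≡0 [] [] _ = refl
hamming≡0 (true ∷ u) (true ∷ v) h = cong (true ∷_) (hamming≡0 u v h)
hamming≡0 (false ∷ u) (false ∷ v) h = cong (false ∷_) (hamming≡0 u v h)

hamming≡1⇒flip : ∀ {m} (u v : Vec Bool m) → hamming u v ≡ 1 → ∃ (FlipAt u v)
hamming≡1⇒flip [] [] ()
hamming≡1⇒flip (true ∷ u) (false ∷ v) h with hamming≡0 u v (suc-injective h)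
... | refl = 0 , flip-head true u
hamming≡1⇒flip (false ∷ u) (true ∷ v) h with hamming≡0 u v (suc-injective h)
... | refl = 0 , flip-head false u
hamming≡1⇒flip (true ∷ u) (true ∷ v) h = let (k , f) = hamming≡1⇒flip u v h in suc k , flip-tail true f
hamming≡1⇒flip (false ∷ u) (false ∷ v) h = let (k , f) = hamming≡1⇒flip u v h in suc k , flip-tail false f

flip⇒hamming≡1 : ∀ {m} (u v : Vec Bool m) k → FlipAt u v k → hamming u v ≡ 1
flip⇒hamming≡1 (x ∷ u) (y ∷ v) zero (_ , flipped , rest)
  with flipped | bit-ext v u (λ j → rest (suc j) (λ ()))
... | refl | refl = trans (cong (_+ hamming u u) (head-changes x)) (cong suc (hamming-self u))
  where
  head-changes : ∀ x → (if x xor not x then 1 else 0) ≡ 1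
  head-changes true = refl
  head-changes false = refl
flip⇒hamming≡1 (x ∷ u) (y ∷ v) (suc k) (s≤s k<m , flipped , rest) with rest 0 (λ ())
... | refl = trans (cong (_+ hamming u v) (same-letter x))
                   (flip⇒hamming≡1 u v k (k<m , flipped , λ j j≢k → rest (suc j) (λ e → j≢k (suc-injective e))))

weight : ∀ {m} → Vec Bool m → ℕ
weight [] = 0
weight (x ∷ xs) = (if x then 1 else 0) + weight xs

weight-flip : ∀ {m} (u v : Vec Bool m) k → FlipAt u v k → bit u k ≡ true → weight u ≡ suc (weight v)
weight-flip (true ∷ u) (y ∷ v) zero (_ , flipped , rest) refl with flipped
... | refl = cong (λ z → suc (weight z)) (bit-ext u v (λ j → sym (rest (suc j) (λ ()))))
weight-flip (x ∷ u) (y ∷ v) (suc k) (s≤s k<m , flipped , rest) one with rest 0 (λ ())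
... | refl = trans (cong ((if x then 1 else 0) +_) tail-drops) (+-suc (if x then 1 else 0) (weight v))
  where
  tail-drops : weight u ≡ suc (weight v)
  tail-drops = weight-flip u v k (k<m , flipped , λ j j≢k → rest (suc j) (λ e → j≢k (suc-injective e))) one

bit-∷ʳ< : ∀ {k} (v : Vec Bool k) x j → j < k → bit (v ∷ʳ x) j ≡ bit v j
bit-∷ʳ< (y ∷ v) x zero _ = refl
bit-∷ʳ< (y ∷ v) x (suc j) (s≤s j<k) = bit-∷ʳ< v x j j<k

bit-∷ʳ : ∀ {k} (v : Vec Bool k) x → bit (v ∷ʳ x) k ≡ x
bit-∷ʳ [] x = refl
bit-∷ʳ (y ∷ v) x = bit-∷ʳ v x

∸-suc : ∀ k j → j < k → k ∸ j ≡ suc (k ∸ suc j)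
∸-suc (suc k) zero _ = refl
∸-suc (suc k) (suc j) (s≤s j<k) = ∸-suc k j j<k

bit-reverse : ∀ {k} (t : Vec Bool k) j → j < k → bit (reverse t) j ≡ bit t (k ∸ suc j)
bit-reverse {suc k} (x ∷ t) j j<1+k = trans (cong (λ z → bit z j) (VecP.reverse-∷ x t)) (by-position (m≤n⇒m<n∨m≡n (s≤s⁻¹ j<1+k)))
  where
  by-position : j < k ⊎ j ≡ k → bit (reverse t ∷ʳ x) j ≡ bit (x ∷ t) (k ∸ j)
  by-position (inj₁ j<k) = trans (bit-∷ʳ< (reverse t) x j j<k) (trans (bit-reverse t j j<k) (cong (bit (x ∷ t)) (sym (∸-suc k j j<k))))
  by-position (inj₂ refl) = trans (bit-∷ʳ (reverse t) x) (cong (bit (x ∷ t)) (sym (n∸n≡0 j)))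

-- Counting with duplicate-free lists: the length of such a list is the
-- size of the set it enumerates.
module _ {A : Set} where

  lookup-injective : ∀ {xs : List A} → Unique xs → ∀ i j → List.lookup xs i ≡ List.lookup xs j → i ≡ j
  lookup-injective {x ∷ xs} (_ ∷ u) Fin.zero Fin.zero e = refl
  lookup-injective {x ∷ xs} (x∉ ∷ u) Fin.zero (Fin.suc j) e = ⊥-elim (All.lookup x∉ (∈-lookup j) e)
  lookup-injective {x ∷ xs} (x∉ ∷ u) (Fin.suc i) Fin.zero e = ⊥-elim (All.lookup x∉ (∈-lookup i) (sym e))
  lookup-injective {x ∷ xs} (_ ∷ u) (Fin.suc i) (Fin.suc j) e = cong Fin.suc (lookup-injective u i j e)

  length-≤-by-injection : ∀ {B : Set} {xs : List A} {ys : List B} → Unique xs →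
    (f : A → B) → (∀ {x y} → f x ≡ f y → x ≡ y) → (∀ x → x ∈ xs → f x ∈ ys) →
    length xs ≤ length ys
  length-≤-by-injection {xs = xs} {ys} u f f-inj maps = FinP.injective⇒≤ {f = φ} φ-inj
    where
    φ : Fin (length xs) → Fin (length ys)
    φ i = Any.index (maps (List.lookup xs i) (∈-lookup i))
    φ-inj : ∀ {i j} → φ i ≡ φ j → i ≡ j
    φ-inj {i} {j} e = lookup-injective u i j (f-inj (begin
      f (List.lookup xs i)          ≡⟨ lookup-index (maps (List.lookup xs i) (∈-lookup i)) ⟩
      List.lookup ys (φ i)          ≡⟨ cong (List.lookup ys) e ⟩
      List.lookup ys (φ j)          ≡⟨ lookup-index (maps (List.lookup xs j) (∈-lookup j)) ⟨
      f (List.lookup xs j)          ∎))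
      where open ≡-Reasoning

  length-≡-by-inclusions : ∀ {xs ys : List A} → Unique xs → Unique ys →
    (∀ x → x ∈ xs → x ∈ ys) → (∀ x → x ∈ ys → x ∈ xs) → length xs ≡ length ys
  length-≡-by-inclusions ux uy xs⊆ys ys⊆xs =
    ≤-antisym (length-≤-by-injection ux (λ x → x) (λ e → e) xs⊆ys)
              (length-≤-by-injection uy (λ x → x) (λ e → e) ys⊆xs)

  length-filter-split : ∀ {P : Pred A Agda.Primitive.lzero} (P? : Decidable P) (xs : List A) →
    length xs ≡ length (filter P? xs) + length (filter (λ x → ¬? (P? x)) xs)
  length-filter-split P? [] = refl
  length-filter-split P? (x ∷ xs) with P? x
  ... | yes _ = cong suc (length-filter-split P? xs)
  ... | no _ = trans (cong suc (length-filter-split P? xs)) (sym (+-suc _ _))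

reverse-∷ʳ : ∀ {A : Set} {m} (xs : Vec A m) x → reverse (xs ∷ʳ x) ≡ x ∷ reverse xs
reverse-∷ʳ [] x = refl
reverse-∷ʳ (y ∷ xs) x = begin
  reverse (y ∷ (xs ∷ʳ x))   ≡⟨ VecP.reverse-∷ y (xs ∷ʳ x) ⟩
  reverse (xs ∷ʳ x) ∷ʳ y    ≡⟨ cong (_∷ʳ y) (reverse-∷ʳ xs x) ⟩
  x ∷ (reverse xs ∷ʳ y)     ≡⟨ cong (x ∷_) (VecP.reverse-∷ y xs) ⟨
  x ∷ reverse (y ∷ xs)      ∎
  where open ≡-Reasoning

wrap : ∀ {A : Set} {k} → A → Vec A k → Vec A (suc (suc k))
wrap a t = a ∷ (t ∷ʳ a)

data WrapView {A : Set} {k} : Vec A (suc (suc k)) → Set where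
  framed : ∀ a (t : Vec A k) b → WrapView (a ∷ (t ∷ʳ b))

wrapView : ∀ {A : Set} {k} (v : Vec A (suc (suc k))) → WrapView v
wrapView (a ∷ r) with initLast r
... | t , b , refl = framed a t b

wrap-injective : ∀ {A : Set} {k} (a : A) {t t' : Vec A k} → wrap a t ≡ wrap a t' → t ≡ t'
wrap-injective a {t} {t'} e = VecP.∷ʳ-injectiveˡ t t' (proj₂ (VecP.∷-injective e))

reverse-ends : ∀ {A : Set} {m} a (t : Vec A m) b → reverse (a ∷ (t ∷ʳ b)) ≡ b ∷ (reverse t ∷ʳ a)
reverse-ends a t b = trans (VecP.reverse-∷ a (t ∷ʳ b)) (cong (_∷ʳ a) (reverse-∷ʳ t b))

reverse-wrap : ∀ {A : Set} {k} (a : A) (t : Vec A k) → reverse (wrap a t) ≡ wrap a (reverse t)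
reverse-wrap a t = reverse-ends a t a

palindrome-ends : ∀ {k} (a b : Bool) (t : Vec Bool k) →
  reverse (a ∷ (t ∷ʳ b)) ≡ a ∷ (t ∷ʳ b) → b ≡ a × reverse t ≡ t
palindrome-ends a b t e with VecP.∷-injective (trans (sym (reverse-ends a t b)) e)
... | b≡a , middle = b≡a , sym (VecP.∷ʳ-injectiveˡ t (reverse t) (sym middle))

headOr : ∀ {m} → Vec Bool m → Bool
headOr [] = false
headOr (x ∷ _) = x

lastOr : ∀ {m} → Vec Bool m → Bool
lastOr [] = false
lastOr (x ∷ []) = x
lastOr (x ∷ y ∷ t) = lastOr (y ∷ t)

lastOr-∷ʳ : ∀ {k} (t : Vec Bool k) x → lastOr (t ∷ʳ x) ≡ x
lastOr-∷ʳ [] x = refl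
lastOr-∷ʳ (y ∷ []) x = refl
lastOr-∷ʳ (y ∷ z ∷ t) x = lastOr-∷ʳ (z ∷ t) x

lastOr-reverse : ∀ {m} (t : Vec Bool m) → lastOr (reverse t) ≡ headOr t
lastOr-reverse [] = refl
lastOr-reverse (x ∷ t) = trans (cong lastOr (VecP.reverse-∷ x t)) (lastOr-∷ʳ (reverse t) x)

lastB-∷ʳ : ∀ {k} (v : Vec Bool (suc k)) x → lastB (v ∷ʳ x) ≡ x
lastB-∷ʳ (y ∷ []) x = refl
lastB-∷ʳ (y ∷ z ∷ v) x = lastB-∷ʳ (z ∷ v) x

noConsec-∷ : ∀ {m} x (t : Vec Bool m) → noConsec (x ∷ t) ≡ not (x ∧ headOr t) ∧ noConsec t
noConsec-∷ x [] = cong (λ z → not z ∧ true) (sym (BoolP.∧-zeroʳ x))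
noConsec-∷ x (y ∷ t) = refl

noConsec-false∷ : ∀ {m} (s : Vec Bool m) → noConsec (false ∷ s) ≡ noConsec s
noConsec-false∷ [] = refl
noConsec-false∷ (x ∷ s) = refl

noConsec-∷ʳ : ∀ {m} (t : Vec Bool m) x → noConsec (t ∷ʳ x) ≡ noConsec t ∧ not (lastOr t ∧ x)
noConsec-∷ʳ [] x = refl
noConsec-∷ʳ (y ∷ []) x = BoolP.∧-comm (not (y ∧ x)) true
noConsec-∷ʳ (y ∷ z ∷ t) x =
  trans (cong (not (y ∧ z) ∧_) (noConsec-∷ʳ (z ∷ t) x)) (sym (BoolP.∧-assoc (not (y ∧ z)) (noConsec (z ∷ t)) _))

noConsec-reverse : ∀ {m} (t : Vec Bool m) → noConsec (reverse t) ≡ noConsec t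
noConsec-reverse [] = refl
noConsec-reverse (x ∷ t) = begin
  noConsec (reverse (x ∷ t))                             ≡⟨ cong noConsec (VecP.reverse-∷ x t) ⟩
  noConsec (reverse t ∷ʳ x)                              ≡⟨ noConsec-∷ʳ (reverse t) x ⟩
  noConsec (reverse t) ∧ not (lastOr (reverse t) ∧ x)    ≡⟨ cong₂ (λ a b → a ∧ not (b ∧ x)) (noConsec-reverse t) (lastOr-reverse t) ⟩
  noConsec t ∧ not (headOr t ∧ x)                        ≡⟨ BoolP.∧-comm (noConsec t) _ ⟩
  not (headOr t ∧ x) ∧ noConsec t                        ≡⟨ cong (λ z → not z ∧ noConsec t) (BoolP.∧-comm (headOr t) x) ⟩
  not (x ∧ headOr t) ∧ noConsec t                        ≡⟨ noConsec-∷ x t ⟨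
  noConsec (x ∷ t)                                       ∎
  where open ≡-Reasoning

noConsec-∷ʳ-false : ∀ {k} (t : Vec Bool k) → noConsec (t ∷ʳ false) ≡ noConsec t
noConsec-∷ʳ-false t = begin
  noConsec (t ∷ʳ false)                    ≡⟨ noConsec-∷ʳ t false ⟩
  noConsec t ∧ not (lastOr t ∧ false)      ≡⟨ cong (λ z → noConsec t ∧ not z) (BoolP.∧-zeroʳ (lastOr t)) ⟩
  noConsec t ∧ true                        ≡⟨ BoolP.∧-identityʳ (noConsec t) ⟩
  noConsec t                               ∎
  where open ≡-Reasoning

noConsec-wrap-false : ∀ {k} (t : Vec Bool k) → noConsec (wrap false t) ≡ noConsec t
noConsec-wrap-false t = trans (noConsec-false∷ (t ∷ʳ false)) (noConsec-∷ʳ-false t)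

-- the palindromes starting with a one are 1 0 t 0 1
wrap-10 : ∀ {k} → Vec Bool k → Vec Bool (suc (suc (suc (suc k))))
wrap-10 t = wrap true (wrap false t)

noConsec-wrap-10 : ∀ {k} (t : Vec Bool k) → noConsec (wrap-10 t) ≡ noConsec t
noConsec-wrap-10 t = begin
  noConsec (true ∷ (wrap false t ∷ʳ true))               ≡⟨ noConsec-∷ true (wrap false t ∷ʳ true) ⟩
  noConsec (wrap false t ∷ʳ true)                        ≡⟨ noConsec-∷ʳ (wrap false t) true ⟩
  noConsec (wrap false t) ∧ not (lastOr (wrap false t) ∧ true)
      ≡⟨ cong₂ (λ a b → a ∧ not (b ∧ true)) (noConsec-wrap-false t) (lastOr-∷ʳ (false ∷ t) false) ⟩
  noConsec t ∧ true                                      ≡⟨ BoolP.∧-identityʳ (noConsec t) ⟩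
  noConsec t                                             ∎
  where open ≡-Reasoning

fibStrings : (m : ℕ) → List (Vec Bool m)
fibStrings zero = [] ∷ []
fibStrings (suc zero) = (false ∷ []) ∷ (true ∷ []) ∷ []
fibStrings (suc (suc m)) = map (false ∷_) (fibStrings (suc m)) ++ map (λ s → true ∷ false ∷ s) (fibStrings m)

length-fibStrings : ∀ m → length (fibStrings m) ≡ F (suc (suc m))
length-fibStrings zero = refl
length-fibStrings (suc zero) = refl
length-fibStrings (suc (suc m)) = begin
  length (map (false ∷_) (fibStrings (suc m)) ++ map (λ s → true ∷ false ∷ s) (fibStrings m))
    ≡⟨ ListP.length-++ (map (false ∷_) (fibStrings (suc m))) ⟩
  length (map (false ∷_) (fibStrings (suc m))) + length (map (λ s → true ∷ false ∷ s) (fibStrings m))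
    ≡⟨ cong₂ _+_ (ListP.length-map _ (fibStrings (suc m))) (ListP.length-map _ (fibStrings m)) ⟩
  length (fibStrings (suc m)) + length (fibStrings m)
    ≡⟨ cong₂ _+_ (length-fibStrings (suc m)) (length-fibStrings m) ⟩
  F (suc (suc (suc (suc m))))  ∎
  where open ≡-Reasoning

fibStrings-unique : ∀ m → Unique (fibStrings m)
fibStrings-unique zero = All.[] ∷ []
fibStrings-unique (suc zero) = ((λ ()) All.∷ All.[]) ∷ All.[] ∷ []
fibStrings-unique (suc (suc m)) =
  UniqueP.++⁺ (UniqueP.map⁺ (λ e → proj₂ (VecP.∷-injective e)) (fibStrings-unique (suc m)))
              (UniqueP.map⁺ (λ e → proj₂ (VecP.∷-injective (proj₂ (VecP.∷-injective e)))) (fibStrings-unique m))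
              disjoint
  where
  disjoint : ∀ {v} → v ∈ map (false ∷_) (fibStrings (suc m)) × v ∈ map (λ s → true ∷ false ∷ s) (fibStrings m) → ⊥
  disjoint (a , b) with ∈-map⁻ (false ∷_) a | ∈-map⁻ (λ s → true ∷ false ∷ s) b
  ... | _ , _ , refl | _ , _ , ()

fibStrings-sound : ∀ m s → s ∈ fibStrings m → T (noConsec s)
fibStrings-sound zero [] _ = tt
fibStrings-sound (suc zero) (false ∷ []) _ = tt
fibStrings-sound (suc zero) (true ∷ []) _ = tt
fibStrings-sound (suc (suc m)) s s∈ with ∈-++⁻ (map (false ∷_) (fibStrings (suc m))) s∈
... | inj₁ q with ∈-map⁻ (false ∷_) q
... | t , t∈ , refl = subst T (sym (noConsec-false∷ t)) (fibStrings-sound (suc m) t t∈)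
fibStrings-sound (suc (suc m)) s s∈ | inj₂ q with ∈-map⁻ (λ s → true ∷ false ∷ s) q
... | t , t∈ , refl = subst T (sym (noConsec-false∷ t)) (fibStrings-sound m t t∈)

fibStrings-complete : ∀ m s → T (noConsec s) → s ∈ fibStrings m
fibStrings-complete zero [] _ = here refl
fibStrings-complete (suc zero) (false ∷ []) _ = here refl
fibStrings-complete (suc zero) (true ∷ []) _ = there (here refl)
fibStrings-complete (suc (suc m)) (false ∷ s) t =
  ∈-++⁺ˡ (∈-map⁺ (false ∷_) (fibStrings-complete (suc m) s (subst T (noConsec-false∷ s) t)))
fibStrings-complete (suc (suc m)) (true ∷ false ∷ s) t =
  ∈-++⁺ʳ (map (false ∷_) (fibStrings (suc m))) (∈-map⁺ (λ s → true ∷ false ∷ s) (fibStrings-complete m s (subst T (noConsec-false∷ s) t)))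
fibStrings-complete (suc (suc m)) (true ∷ true ∷ s) ()

palindromes : (m : ℕ) → List (Vec Bool m)
palindromes zero = [] ∷ []
palindromes (suc zero) = (false ∷ []) ∷ (true ∷ []) ∷ []
palindromes (suc (suc zero)) = (false ∷ false ∷ []) ∷ []
palindromes (suc (suc (suc zero))) =
  (false ∷ false ∷ false ∷ []) ∷ (false ∷ true ∷ false ∷ []) ∷ (true ∷ false ∷ true ∷ []) ∷ []
palindromes (suc (suc (suc (suc m)))) = map (wrap false) (palindromes (suc (suc m))) ++ map wrap-10 (palindromes m)

palindromes-unique : ∀ m → Unique (palindromes m)
palindromes-unique zero = All.[] ∷ []
palindromes-unique (suc zero) = ((λ ()) All.∷ All.[]) ∷ All.[] ∷ []
palindromes-unique (suc (suc zero)) = All.[] ∷ []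
palindromes-unique (suc (suc (suc zero))) =
  ((λ ()) All.∷ (λ ()) All.∷ All.[]) ∷ ((λ ()) All.∷ All.[]) ∷ All.[] ∷ []
palindromes-unique (suc (suc (suc (suc m)))) =
  UniqueP.++⁺ (UniqueP.map⁺ (wrap-injective false) (palindromes-unique (suc (suc m))))
              (UniqueP.map⁺ (λ e → wrap-injective false (wrap-injective true e)) (palindromes-unique m))
              disjoint
  where
  disjoint : ∀ {v} → v ∈ map (wrap false) (palindromes (suc (suc m))) × v ∈ map wrap-10 (palindromes m) → ⊥
  disjoint (a , b) with ∈-map⁻ (wrap false) a | ∈-map⁻ wrap-10 b
  ... | _ , _ , refl | _ , _ , ()

Palindrome : ∀ {m} → Vec Bool m → Set
Palindrome s = reverse s ≡ s

palindrome-wrap : ∀ {A : Set} {k} (a : A) (t : Vec A k) → reverse t ≡ t → reverse (wrap a t) ≡ wrap a t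
palindrome-wrap a t p = trans (reverse-wrap a t) (cong (wrap a) p)

palindromes-sound : ∀ m s → s ∈ palindromes m → T (noConsec s) × Palindrome s
palindromes-sound zero [] _ = tt , refl
palindromes-sound (suc zero) (false ∷ []) _ = tt , refl
palindromes-sound (suc zero) (true ∷ []) _ = tt , refl
palindromes-sound (suc (suc zero)) _ (here refl) = tt , refl
palindromes-sound (suc (suc (suc zero))) _ (here refl) = tt , refl
palindromes-sound (suc (suc (suc zero))) _ (there (here refl)) = tt , refl
palindromes-sound (suc (suc (suc zero))) _ (there (there (here refl))) = tt , refl
palindromes-sound (suc (suc (suc (suc m)))) = step (palindromes-sound (suc (suc m))) (palindromes-sound m)
  where
  Sound : ∀ {k} → List (Vec Bool k) → Set
  Sound xs = ∀ s → s ∈ xs → T (noConsec s) × Palindrome s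
  step : Sound (palindromes (suc (suc m))) → Sound (palindromes m) → Sound (palindromes (suc (suc (suc (suc m)))))
  step ih₂ ih₄ s s∈ with ∈-++⁻ (map (wrap false) (palindromes (suc (suc m)))) s∈
  ... | inj₁ q with ∈-map⁻ (wrap false) q
  ... | t , t∈ , refl =
    let (nc , pal) = ih₂ t t∈ in
    subst T (sym (noConsec-wrap-false t)) nc , palindrome-wrap false t pal
  step ih₂ ih₄ s s∈ | inj₂ q with ∈-map⁻ wrap-10 q
  ... | t , t∈ , refl =
    let (nc , pal) = ih₄ t t∈ in
    subst T (sym (noConsec-wrap-10 t)) nc , palindrome-wrap true (wrap false t) (palindrome-wrap false t pal)

palindromes-complete : ∀ m s → T (noConsec s) → Palindrome s → s ∈ palindromes m
palindromes-complete zero [] _ _ = here refl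
palindromes-complete (suc zero) (false ∷ []) _ _ = here refl
palindromes-complete (suc zero) (true ∷ []) _ _ = there (here refl)
palindromes-complete (suc (suc zero)) (false ∷ false ∷ []) _ _ = here refl
palindromes-complete (suc (suc zero)) (true ∷ true ∷ []) () _
palindromes-complete (suc (suc zero)) (false ∷ true ∷ []) _ ()
palindromes-complete (suc (suc zero)) (true ∷ false ∷ []) _ ()
palindromes-complete (suc (suc (suc zero))) (false ∷ false ∷ false ∷ []) _ _ = here refl
palindromes-complete (suc (suc (suc zero))) (false ∷ true ∷ false ∷ []) _ _ = there (here refl)
palindromes-complete (suc (suc (suc zero))) (true ∷ false ∷ true ∷ []) _ _ = there (there (here refl))
palindromes-complete (suc (suc (suc zero))) (false ∷ false ∷ true ∷ []) _ ()
palindromes-complete (suc (suc (suc zero))) (true ∷ false ∷ false ∷ []) _ ()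
palindromes-complete (suc (suc (suc zero))) (false ∷ true ∷ true ∷ []) () _
palindromes-complete (suc (suc (suc zero))) (true ∷ true ∷ x ∷ []) () _
palindromes-complete (suc (suc (suc (suc m)))) = step (palindromes-complete (suc (suc m))) (palindromes-complete m)
  where
  Complete : ∀ {k} → List (Vec Bool k) → Set
  Complete xs = ∀ s → T (noConsec s) → Palindrome s → s ∈ xs
  step : Complete (palindromes (suc (suc m))) → Complete (palindromes m) → Complete (palindromes (suc (suc (suc (suc m)))))
  step ih₂ ih₄ s nc pal with wrapView s
  ... | framed a t b with palindrome-ends a b t pal
  ... | refl , pal-t with a
  ... | false = ∈-++⁺ˡ (∈-map⁺ (wrap false) (ih₂ t (subst T (noConsec-wrap-false t) nc) pal-t))
  ... | true with wrapView t
  ... | framed c t' d with palindrome-ends c d t' pal-t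
  ... | refl , pal-t' with c
  ... | false = ∈-++⁺ʳ (map (wrap false) (palindromes (suc (suc m))))
                       (∈-map⁺ wrap-10 (ih₄ t' (subst T (noConsec-wrap-10 t') nc) pal-t'))
  ... | true = ⊥-elim nc

idx-suc-suc : ∀ k → idx (suc (suc k)) ≡ suc (idx k)
idx-suc-suc k = m/n≡1+[m∸n]/n {suc (suc (k + onePlusSign k))} {2} (s≤s (s≤s z≤n))

length-palindromes : ∀ m → length (palindromes m) ≡ F (idx (suc (suc (suc m))))
length-palindromes zero = refl
length-palindromes (suc zero) = refl
length-palindromes (suc (suc zero)) = refl
length-palindromes (suc (suc (suc zero))) = refl
length-palindromes (suc (suc (suc (suc m)))) = begin
  length (map (wrap false) (palindromes (suc (suc m))) ++ map wrap-10 (palindromes m))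
    ≡⟨ ListP.length-++ (map (wrap false) (palindromes (suc (suc m)))) ⟩
  length (map (wrap false) (palindromes (suc (suc m)))) + length (map wrap-10 (palindromes m))
    ≡⟨ cong₂ _+_ (ListP.length-map _ (palindromes (suc (suc m)))) (ListP.length-map _ (palindromes m)) ⟩
  length (palindromes (suc (suc m))) + length (palindromes m)
    ≡⟨ cong₂ _+_ (length-palindromes (suc (suc m))) (length-palindromes m) ⟩
  F (idx (5 + m)) + F (idx (3 + m))          ≡⟨ cong (λ z → F z + F (idx (3 + m))) (idx-suc-suc (3 + m)) ⟩
  F (suc (suc (idx (3 + m))))                ≡⟨ cong F (trans (idx-suc-suc (5 + m)) (cong suc (idx-suc-suc (3 + m)))) ⟨
  F (idx (7 + m))                            ∎
  where open ≡-Reasoning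

-- Lexicographic order with false < true; it picks one string out of each
-- pair {s, reverse s} of distinct strings.
_<lex_ : ∀ {m} → Vec Bool m → Vec Bool m → Bool
[] <lex [] = false
(false ∷ xs) <lex (true ∷ ys) = true
(true ∷ xs) <lex (false ∷ ys) = false
(false ∷ xs) <lex (false ∷ ys) = xs <lex ys
(true ∷ xs) <lex (true ∷ ys) = xs <lex ys

<lex-asym : ∀ {m} (s t : Vec Bool m) → s <lex t ≡ true → t <lex s ≡ false
<lex-asym [] [] ()
<lex-asym (false ∷ s) (true ∷ t) _ = refl
<lex-asym (false ∷ s) (false ∷ t) s<t = <lex-asym s t s<t
<lex-asym (true ∷ s) (true ∷ t) s<t = <lex-asym s t s<t

<lex-connex : ∀ {m} (s t : Vec Bool m) → s ≢ t → s <lex t ≡ true ⊎ t <lex s ≡ true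
<lex-connex [] [] s≢t = ⊥-elim (s≢t refl)
<lex-connex (false ∷ s) (true ∷ t) _ = inj₁ refl
<lex-connex (true ∷ s) (false ∷ t) _ = inj₂ refl
<lex-connex (false ∷ s) (false ∷ t) s≢t = <lex-connex s t (λ e → s≢t (cong (false ∷_) e))
<lex-connex (true ∷ s) (true ∷ t) s≢t = <lex-connex s t (λ e → s≢t (cong (true ∷_) e))

-- The non-palindromic Fibonacci strings of length m split into those below
-- their reversal and those above it; reversal exchanges the two halves, so
-- each half has (F(m+2) - F(idx (m+3)))/2 elements.
module NonPalindromes (m : ℕ) where

  palindrome? : (s : Vec Bool m) → Dec (Palindrome s)
  palindrome? s = VecP.≡-dec BoolP._≟_ (reverse s) s

  Below : Vec Bool m → Set
  Below s = s <lex reverse s ≡ true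

  below? : (s : Vec Bool m) → Dec (Below s)
  below? s = s <lex reverse s BoolP.≟ true

  nonPalindromes : List (Vec Bool m)
  nonPalindromes = filter (λ s → ¬? (palindrome? s)) (fibStrings m)

  below : List (Vec Bool m)
  below = filter below? nonPalindromes

  above : List (Vec Bool m)
  above = filter (λ s → ¬? (below? s)) nonPalindromes

  nonPalindromes-unique : Unique nonPalindromes
  nonPalindromes-unique = UniqueP.filter⁺ (λ s → ¬? (palindrome? s)) (fibStrings-unique m)

  below-unique : Unique below
  below-unique = UniqueP.filter⁺ below? nonPalindromes-unique

  record IsBelow (s : Vec Bool m) : Set where
    field
      fibonacci : T (noConsec s)
      not-palindrome : ¬ Palindrome s
      is-below : Below s

  below-sound : ∀ s → s ∈ below → IsBelow s
  below-sound s s∈ =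
    let (s∈nonPal , s-below) = ∈-filter⁻ below? {xs = nonPalindromes} s∈
        (s∈fib , s-nonPal) = ∈-filter⁻ (λ s → ¬? (palindrome? s)) {xs = fibStrings m} s∈nonPal
    in record { fibonacci = fibStrings-sound m s s∈fib ; not-palindrome = s-nonPal ; is-below = s-below }

  below-complete : ∀ s → T (noConsec s) → ¬ Palindrome s → Below s → s ∈ below
  below-complete s nc np lt =
    ∈-filter⁺ below? (∈-filter⁺ (λ s → ¬? (palindrome? s)) (fibStrings-complete m s nc) np) lt

  reverse-fibonacci : (s : Vec Bool m) → T (noConsec s) → T (noConsec (reverse s))
  reverse-fibonacci s nc = subst T (sym (noConsec-reverse s)) nc

  reverse-non-palindrome : (s : Vec Bool m) → ¬ Palindrome s → ¬ Palindrome (reverse s)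
  reverse-non-palindrome s np e = np (trans (sym e) (VecP.reverse-involutive s))

  below→above : ∀ s → s ∈ below → reverse s ∈ above
  below→above s s∈ =
    ∈-filter⁺ (λ s → ¬? (below? s))
      (∈-filter⁺ (λ s → ¬? (palindrome? s)) (fibStrings-complete m (reverse s) (reverse-fibonacci s fibonacci))
        (reverse-non-palindrome s not-palindrome))
      reverse-not-below
    where
    open IsBelow (below-sound s s∈)
    reverse-not-below : ¬ Below (reverse s)
    reverse-not-below e = BoolP.not-¬ refl (begin
      false                                   ≡⟨ <lex-asym s (reverse s) is-below ⟨
      reverse s <lex s                        ≡⟨ cong (reverse s <lex_) (VecP.reverse-involutive s) ⟨
      reverse s <lex reverse (reverse s)      ≡⟨ e ⟩
      true                                    ∎)
      where open ≡-Reasoning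

  above→below : ∀ s → s ∈ above → reverse s ∈ below
  above→below s s∈ with ∈-filter⁻ (λ s → ¬? (below? s)) {xs = nonPalindromes} s∈
  ... | s∈nonPal , s-not-below with ∈-filter⁻ (λ s → ¬? (palindrome? s)) {xs = fibStrings m} s∈nonPal
  ... | s∈fib , s-nonPal =
    below-complete (reverse s) (reverse-fibonacci s (fibStrings-sound m s s∈fib))
      (reverse-non-palindrome s s-nonPal) reverse-below
    where
    reverse-below : Below (reverse s)
    reverse-below with <lex-connex s (reverse s) (λ e → s-nonPal (sym e))
    ... | inj₁ s-below = ⊥-elim (s-not-below s-below)
    ... | inj₂ s-above = trans (cong (reverse s <lex_) (VecP.reverse-involutive s)) s-above

  length-below≡length-above : length below ≡ length above
  length-below≡length-above = ≤-antisym
    (length-≤-by-injection below-unique reverse VecP.reverse-injective below→above)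
    (length-≤-by-injection (UniqueP.filter⁺ (λ s → ¬? (below? s)) nonPalindromes-unique) reverse VecP.reverse-injective above→below)

  length-filter-palindromes : length (filter palindrome? (fibStrings m)) ≡ length (palindromes m)
  length-filter-palindromes = length-≡-by-inclusions (UniqueP.filter⁺ palindrome? (fibStrings-unique m)) (palindromes-unique m)
    (λ s s∈ → let (s∈fib , pal) = ∈-filter⁻ palindrome? {xs = fibStrings m} s∈ in
              palindromes-complete m s (fibStrings-sound m s s∈fib) pal)
    (λ s s∈ → let (nc , pal) = palindromes-sound m s s∈ in ∈-filter⁺ palindrome? (fibStrings-complete m s nc) pal)

  length-below : length below ≡ (F (suc (suc m)) ∸ F (idx (suc (suc (suc m))))) / 2
  length-below = sym (begin
    (F (suc (suc m)) ∸ P) / 2                 ≡⟨ cong (λ z → (z ∸ P) / 2) all-strings ⟩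
    (P + (L + L) ∸ P) / 2                     ≡⟨ cong (_/ 2) (m+n∸m≡n P (L + L)) ⟩
    (L + L) / 2                               ≡⟨ cong (_/ 2) (trans (cong (L +_) (sym (+-identityʳ L))) (*-comm 2 L)) ⟩
    L * 2 / 2                                 ≡⟨ m*n/n≡m L 2 ⟩
    L                                         ∎)
    where
    open ≡-Reasoning
    L P : ℕ
    L = length below
    P = F (idx (suc (suc (suc m))))
    all-strings : F (suc (suc m)) ≡ P + (L + L)
    all-strings = begin
      F (suc (suc m))                                              ≡⟨ length-fibStrings m ⟨
      length (fibStrings m)                                        ≡⟨ length-filter-split palindrome? (fibStrings m) ⟩
      length (filter palindrome? (fibStrings m)) + length nonPalindromes
        ≡⟨ cong₂ _+_ (trans length-filter-palindromes (length-palindromes m)) (length-filter-split below? nonPalindromes) ⟩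
      P + (L + length above)                                       ≡⟨ cong (λ z → P + (L + z)) length-below≡length-above ⟨
      P + (L + L)                                                  ∎

vertex-≡ : ∀ {m} {x y : V m} → proj₁ x ≡ proj₁ y → x ≡ y
vertex-≡ {x = u , p} {y = .u , q} refl = cong (u ,_) (BoolP.T-irrelevant p q)

module _ {m : ℕ} (g : Aut m) where

  inv : V m → V m
  inv = Inverse.from (Aut.perm g)

  act-inv : ∀ y → act g (inv y) ≡ y
  act-inv = Inverse.strictlyInverseˡ (Aut.perm g)

  inv-act : ∀ x → inv (act g x) ≡ x
  inv-act = Inverse.strictlyInverseʳ (Aut.perm g)

  act-injective : ∀ {x y} → act g x ≡ act g y → x ≡ y
  act-injective {x} {y} e = trans (sym (inv-act x)) (trans (cong inv e) (inv-act y))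

  adj-preserved : ∀ u v → Adj u v → Adj (act g u) (act g v)
  adj-preserved u v = Equivalence.to (Aut.preserve g u v)

  adj-reflected : ∀ u v → Adj (act g u) (act g v) → Adj u v
  adj-reflected u v = Equivalence.from (Aut.preserve g u v)

_∘ᴬ_ : ∀ {m} → Aut m → Aut m → Aut m
g ∘ᴬ h = record
  { perm = mk↔ₛ′ (λ x → act g (act h x)) (λ y → inv h (inv g y))
      (λ y → trans (cong (act g) (act-inv h (inv g y))) (act-inv g y))
      (λ x → trans (cong (inv h) (inv-act g (act h x))) (inv-act h x))
  ; preserve = λ u v → mk⇔ (λ a → adj-preserved g _ _ (adj-preserved h u v a))
                           (λ a → adj-reflected h u v (adj-reflected g _ _ a)) }

inverseᴬ : ∀ {m} → Aut m → Aut m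
inverseᴬ g = record
  { perm = mk↔ₛ′ (inv g) (act g) (inv-act g) (act-inv g)
  ; preserve = λ u v → mk⇔ (λ a → adj-reflected g _ _ (subst₂ Adj (sym (act-inv g u)) (sym (act-inv g v)) a))
                           (λ a → subst₂ Adj (act-inv g u) (act-inv g v) (adj-preserved g _ _ a)) }

module _ {m : ℕ} where

  SamePair-sym : ∀ {p q : V m × V m} → SamePair p q → SamePair q p
  SamePair-sym (inj₁ (a , b)) = inj₁ (sym a , sym b)
  SamePair-sym (inj₂ (a , b)) = inj₂ (sym b , sym a)

  SamePair-trans : ∀ {p q r : V m × V m} → SamePair p q → SamePair q r → SamePair p r
  SamePair-trans (inj₁ (refl , refl)) s = s
  SamePair-trans (inj₂ (refl , refl)) (inj₁ (refl , refl)) = inj₂ (refl , refl)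
  SamePair-trans (inj₂ (refl , refl)) (inj₂ (refl , refl)) = inj₁ (refl , refl)

  SamePair-act : ∀ (g : Aut m) {p q : V m × V m} → SamePair p q →
    SamePair (act g (proj₁ p) , act g (proj₂ p)) (act g (proj₁ q) , act g (proj₂ q))
  SamePair-act g (inj₁ (refl , refl)) = inj₁ (refl , refl)
  SamePair-act g (inj₂ (refl , refl)) = inj₂ (refl , refl)

  ≈E-sym : ∀ {e e' : Edge m} → e ≈E e' → e' ≈E e
  ≈E-sym = SamePair-sym

  ≈E-trans : ∀ {e e' e'' : Edge m} → e ≈E e' → e' ≈E e'' → e ≈E e''
  ≈E-trans = SamePair-trans

  InOrbit-trans : ∀ {e₁ e₂ e₃ : Edge m} → InOrbit e₁ e₂ → InOrbit e₂ e₃ → InOrbit e₁ e₃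
  InOrbit-trans {(u₁ , v₁) , _} {(u₂ , v₂) , _} (g₁ , s₁) (g₂ , s₂) =
    g₂ ∘ᴬ g₁ , SamePair-trans (SamePair-act g₂ {q = u₂ , v₂} s₁) s₂

  InOrbit-sym : ∀ {e₁ e₂ : Edge m} → InOrbit e₁ e₂ → InOrbit e₂ e₁
  InOrbit-sym {(u₁ , v₁) , _} (g , s) =
    inverseᴬ g , SamePair-trans (SamePair-sym (SamePair-act (inverseᴬ g) s))
                                (inj₁ (inv-act g u₁ , inv-act g v₁))

  OrbitSize-transfer : ∀ {e₁ e₂ : Edge m} {k} → InOrbit e₁ e₂ → OrbitSize e₁ k → OrbitSize e₂ k
  OrbitSize-transfer {e₁} {e₂} o (f , f-inj , f-in , f-onto) =
    f , f-inj , (λ i → InOrbit-trans {e₁ = e₂} {e₂ = e₁} {e₃ = f i} (InOrbit-sym {e₁ = e₁} {e₂ = e₂} o) (f-in i)) ,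
    (λ e' o' → f-onto e' (InOrbit-trans {e₁ = e₁} {e₂ = e₂} {e₃ = e'} o o'))

  OrbitSize-unique : ∀ {e : Edge m} {k k'} → OrbitSize e k → OrbitSize e k' → k ≡ k'
  OrbitSize-unique {e} {k} {k'} (f , f-inj , f-in , f-onto) (f' , f'-inj , f'-in , f'-onto) =
    FinP.cantor-schröder-bernstein {f = φ} {g = ψ} φ-inj ψ-inj
    where
    φ : Fin k → Fin k'
    φ i = proj₁ (f'-onto (f i) (f-in i))
    ψ : Fin k' → Fin k
    ψ j = proj₁ (f-onto (f' j) (f'-in j))
    φ-inj : ∀ {i i'} → φ i ≡ φ i' → i ≡ i'
    φ-inj {i} {i'} e = f-inj i i' (≈E-trans {e = f i} {e' = f' (φ i)} {e'' = f i'}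
                                   (≈E-sym {e = f' (φ i)} {e' = f i} (proj₂ (f'-onto (f i) (f-in i))))
                                   (subst (λ z → f' z ≈E f i') (sym e) (proj₂ (f'-onto (f i') (f-in i')))))
    ψ-inj : ∀ {j j'} → ψ j ≡ ψ j' → j ≡ j'
    ψ-inj {j} {j'} e = f'-inj j j' (≈E-trans {e = f' j} {e' = f (ψ j)} {e'' = f' j'}
                                    (≈E-sym {e = f (ψ j)} {e' = f' j} (proj₂ (f-onto (f' j) (f'-in j))))
                                    (subst (λ z → f z ≈E f' j') (sym e) (proj₂ (f-onto (f' j') (f'-in j')))))

  OrbitSize-⊎ : ∀ {e : Edge m} {k l} (f : Fin k ⊎ Fin l → Edge m) → (∀ x y → f x ≈E f y → x ≡ y) →
    (∀ x → InOrbit e (f x)) → (∀ e' → InOrbit e e' → ∃ λ x → f x ≈E e') → OrbitSize e (k + l)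
  OrbitSize-⊎ {e} {k} {l} f f-inj f-in f-onto = f ∘ splitAt k , injective , f-in ∘ splitAt k , onto
    where
    injective : ∀ i j → f (splitAt k i) ≈E f (splitAt k j) → i ≡ j
    injective i j h = begin
      i                          ≡⟨ FinP.join-splitAt k l i ⟨
      join k l (splitAt k i)     ≡⟨ cong (join k l) (f-inj (splitAt k i) (splitAt k j) h) ⟩
      join k l (splitAt k j)     ≡⟨ FinP.join-splitAt k l j ⟩
      j                          ∎
      where open ≡-Reasoning
    onto : ∀ e' → InOrbit e e' → ∃ λ i → f (splitAt k i) ≈E e'
    onto e' o with f-onto e' o
    ... | x , fx≈e' = join k l x , subst (λ y → f y ≈E e') (sym (FinP.splitAt-join k l x)) fx≈e'

-- Strings of length n = N + 1 read cyclically: positions are natural numbers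
-- taken modulo n.
module Cyclic (N : ℕ) where

  n : ℕ
  n = suc N

  infix 4 _≈_
  record _≈_ (a b : ℕ) : Set where
    constructor mk≈
    field residue : a % n ≡ b % n
  open _≈_ public

  ≈-refl : ∀ {a} → a ≈ a
  ≈-refl = mk≈ refl

  ≈-sym : ∀ {a b} → a ≈ b → b ≈ a
  ≈-sym (mk≈ p) = mk≈ (sym p)

  ≈-trans : ∀ {a b c} → a ≈ b → b ≈ c → a ≈ c
  ≈-trans (mk≈ p) (mk≈ q) = mk≈ (trans p q)

  ≈-setoid : Setoid _ _
  ≈-setoid = record { _≈_ = _≈_ ; isEquivalence = record { refl = ≈-refl ; sym = ≈-sym ; trans = ≈-trans } }

  module ≈-Reasoning = SetoidReasoning ≈-setoid

  ≈-dec : ∀ a b → Dec (a ≈ b)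
  ≈-dec a b with a % n ≟ b % n
  ... | yes p = yes (mk≈ p)
  ... | no p = no (λ q → p (residue q))

  ≡⇒≈ : ∀ {a b} → a ≡ b → a ≈ b
  ≡⇒≈ refl = ≈-refl

  +-cong : ∀ {a b c d} → a ≈ b → c ≈ d → a + c ≈ b + d
  +-cong {a} {b} {c} {d} (mk≈ p) (mk≈ q) = mk≈ (begin
    (a + c) % n          ≡⟨ %-distribˡ-+ a c n ⟩
    (a % n + c % n) % n  ≡⟨ cong₂ (λ x y → (x + y) % n) p q ⟩
    (b % n + d % n) % n  ≡⟨ %-distribˡ-+ b d n ⟨
    (b + d) % n          ∎)
    where open ≡-Reasoning

  *-cong : ∀ {a b c d} → a ≈ b → c ≈ d → a * c ≈ b * d
  *-cong {a} {b} {c} {d} (mk≈ p) (mk≈ q) = mk≈ (begin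
    (a * c) % n              ≡⟨ %-distribˡ-* a c n ⟩
    (a % n * (c % n)) % n    ≡⟨ cong₂ (λ x y → (x * y) % n) p q ⟩
    (b % n * (d % n)) % n    ≡⟨ %-distribˡ-* b d n ⟨
    (b * d) % n              ∎)
    where open ≡-Reasoning

  %≈ : ∀ a → a % n ≈ a
  %≈ a = mk≈ (m%n%n≡m%n a n)

  n≈0 : n ≈ 0
  n≈0 = mk≈ (n%n≡0 n)

  *n≈0 : ∀ k → k * n ≈ 0
  *n≈0 k = mk≈ (m*n%n≡0 k n)

  +≈0 : ∀ {a b} → b ≈ 0 → a + b ≈ a
  +≈0 {a} p = ≈-trans (+-cong (≈-refl {a}) p) (≡⇒≈ (+-identityʳ a))

  +-inverse : ∀ a → a + N * a ≈ 0
  +-inverse a = ≈-trans (≡⇒≈ (*-comm n a)) (*n≈0 a)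

  +-cancelˡ : ∀ a {b c} → a + b ≈ a + c → b ≈ c
  +-cancelˡ a {b} {c} p = ≈-trans (≈-sym (undo b)) (≈-trans (+-cong (≈-refl {N * a}) p) (undo c))
    where
    undo : ∀ x → N * a + (a + x) ≈ x
    undo x = ≈-trans (≡⇒≈ (rearrange N a x)) (+≈0 {x} (≈-trans (≡⇒≈ (*-comm (suc N) a)) (*n≈0 a)))
      where
      rearrange : ∀ N a x → N * a + (a + x) ≡ x + suc N * a
      rearrange = solve-∀

  N*N≈1 : N * N ≈ 1
  N*N≈1 = +-cancelˡ N (≈-trans (≡⇒≈ (sym (*-suc N N))) (≈-trans (*n≈0 N) (≈-sym (≈-trans (≡⇒≈ (+-comm N 1)) n≈0))))

  <n⇒≡ : ∀ {a b} → a < n → b < n → a ≈ b → a ≡ b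
  <n⇒≡ p q e = trans (sym (m<n⇒m%n≡m p)) (trans (residue e) (m<n⇒m%n≡m q))

  -- The letter at a cyclic position.  Kept opaque (as are `toggle` and
  -- `dihedral` below): later reasoning only uses the lemmas of the block,
  -- which keeps the terms Agda has to compare small.
  opaque
    at : ∀ {A : Set} → Vec A n → ℕ → A
    at u i = lookup u (i mod n)

    at-cong : ∀ {A : Set} (u : Vec A n) {i j} → i ≈ j → at u i ≡ at u j
    at-cong u {i} {j} p = cong (lookup u) (FinP.toℕ-injective
      (trans (FinP.toℕ-fromℕ< (m%n<n i n)) (trans (residue p) (sym (FinP.toℕ-fromℕ< (m%n<n j n))))))

    at-ext : ∀ {A : Set} (u v : Vec A n) → (∀ i → at u i ≡ at v i) → u ≡ v
    at-ext u v h = begin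
      u                       ≡⟨ VecP.tabulate∘lookup u ⟨
      tabulate (lookup u)     ≡⟨ VecP.tabulate-cong (λ i → trans (sym (at-toℕ u i)) (trans (h (toℕ i)) (at-toℕ v i))) ⟩
      tabulate (lookup v)     ≡⟨ VecP.tabulate∘lookup v ⟩
      v                       ∎
      where
      open ≡-Reasoning
      at-toℕ : ∀ {A : Set} (u : Vec A n) (i : Fin n) → at u (toℕ i) ≡ lookup u i
      at-toℕ u i = cong (lookup u) (FinP.toℕ-injective
        (trans (FinP.toℕ-fromℕ< (m%n<n (toℕ i) n)) (m<n⇒m%n≡m (FinP.toℕ<n i))))

    at-tabulate : ∀ {A : Set} (f : ℕ → A) → (∀ {i j} → i ≈ j → f i ≡ f j) →
      ∀ i → at (tabulate {n = n} (λ k → f (toℕ k))) i ≡ f i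
    at-tabulate f f-cong i = trans (VecP.lookup∘tabulate (λ k → f (toℕ k)) (i mod n))
      (f-cong (≈-trans (≡⇒≈ (FinP.toℕ-fromℕ< (m%n<n i n))) (%≈ i)))

    at≡bit : (u : Vec Bool n) (i : ℕ) → at u i ≡ bit u (i % n)
    at≡bit u i = trans (lookup≡bit u (i mod n)) (cong (bit u) (FinP.toℕ-fromℕ< (m%n<n i n)))

    at-replicate : ∀ {A : Set} (x : A) i → at (replicate n x) i ≡ x
    at-replicate x i = VecP.lookup-replicate (i mod n) x

  at≡bit< : (u : Vec Bool n) {i : ℕ} → i < n → at u i ≡ bit u i
  at≡bit< u {i} i<n = trans (at≡bit u i) (cong (bit u) (m<n⇒m%n≡m i<n))

  CyclicLucas : Vec Bool n → Set
  CyclicLucas u = ∀ i → at u i ∧ at u (suc i) ≡ false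

  letters⇒cyclic : (u : Vec Bool n) → LucasLetters u → CyclicLucas u
  letters⇒cyclic u (noAdj , ends) i =
    trans (cong₂ _∧_ (at≡bit u i) (at-cong u (+-cong {1} ≈-refl (≈-sym (%≈ i)))))
          (from-residue (i % n) (m%n<n i n))
    where
    from-residue : ∀ r → r < n → bit u r ∧ at u (suc r) ≡ false
    from-residue r r<n with m≤n⇒m<n∨m≡n r<n
    ... | inj₁ 1+r<n = trans (cong (bit u r ∧_) (at≡bit< u 1+r<n)) (noAdj r)
    ... | inj₂ 1+r≡n with suc-injective 1+r≡n
    ... | refl = trans (cong (bit u N ∧_) (trans (at-cong u n≈0) (at≡bit< u (s≤s z≤n))))
                       (trans (BoolP.∧-comm (bit u N) (bit u 0)) ends)

  cyclic⇒letters : (u : Vec Bool n) → CyclicLucas u → LucasLetters u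
  cyclic⇒letters u h = noAdj , ends
    where
    noAdj : NoAdjacentOnes u
    noAdj k with suc k <? n
    ... | yes 1+k<n = trans (cong₂ _∧_ (sym (at≡bit< u (<-trans (n<1+n k) 1+k<n))) (sym (at≡bit< u 1+k<n))) (h k)
    ... | no 1+k≮n = trans (cong (bit u k ∧_) (bit-outside u (suc k) (≮⇒≥ 1+k≮n))) (BoolP.∧-zeroʳ (bit u k))
    ends : bit u 0 ∧ bit u N ≡ false
    ends = trans (cong₂ _∧_ (trans (sym (at≡bit< u (s≤s z≤n))) (at-cong u (≈-sym n≈0))) (sym (at≡bit< u ≤-refl)))
                 (trans (BoolP.∧-comm (at u n) (at u N)) (h N))

  isLucas⇒cyclic : (u : Vec Bool n) → T (isLucas u) → CyclicLucas u
  isLucas⇒cyclic u t = letters⇒cyclic u (isLucas⇒ u t)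

  cyclic⇒isLucas : (u : Vec Bool n) → CyclicLucas u → T (isLucas u)
  cyclic⇒isLucas u h = ⇒isLucas u (cyclic⇒letters u h)

  lucas-by : ∀ u → (∀ i → at u i ≡ true → at u (suc i) ≡ true → ⊥) → CyclicLucas u
  lucas-by u h i with at u i in e₁ | at u (suc i) in e₂
  ... | false | _ = refl
  ... | true | false = refl
  ... | true | true = ⊥-elim (h i e₁ e₂)

  lucas-below : ∀ u w → CyclicLucas u → (∀ i → at w i ≡ true → at u i ≡ true) → CyclicLucas w
  lucas-below u w h w⊆u = lucas-by w (λ i e₁ e₂ → BoolP.not-¬ refl (trans (sym (cong₂ _∧_ (w⊆u i e₁) (w⊆u (suc i) e₂))) (h i)))

  record Diff (u v : Vec Bool n) (p : ℕ) : Set where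
    constructor diff
    field
      flipped : at v p ≡ not (at u p)
      unchanged : ∀ i → ¬ (i ≈ p) → at v i ≡ at u i
  open Diff public

  hamming≡1⇒Diff : (u v : Vec Bool n) → hamming u v ≡ 1 → Σ ℕ λ p → p < n × Diff u v p
  hamming≡1⇒Diff u v h with hamming≡1⇒flip u v h
  ... | k , k<n , b , c = k , k<n , diff
    (trans (at≡bit< v k<n) (trans b (cong not (sym (at≡bit< u k<n)))))
    (λ i i≉k → trans (at≡bit v i) (trans (c (i % n) (λ e → i≉k (mk≈ (trans e (sym (m<n⇒m%n≡m k<n))))))
                                           (sym (at≡bit u i))))

  Diff⇒FlipAt : (u v : Vec Bool n) (p : ℕ) → Diff u v p → FlipAt u v (p % n)
  Diff⇒FlipAt u v p (diff b c) = m%n<n p n , trans (sym (at≡bit v p)) (trans b (cong not (at≡bit u p))) , rest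
    where
    rest : ∀ j → j ≢ p % n → bit v j ≡ bit u j
    rest j j≢p with j <? n
    ... | yes j<n = trans (sym (at≡bit< v j<n))
                          (trans (c j (λ r → j≢p (trans (sym (m<n⇒m%n≡m j<n)) (residue r)))) (at≡bit< u j<n))
    ... | no j≮n = trans (bit-outside v j (≮⇒≥ j≮n)) (sym (bit-outside u j (≮⇒≥ j≮n)))

  Diff⇒hamming≡1 : (u v : Vec Bool n) (p : ℕ) → Diff u v p → hamming u v ≡ 1
  Diff⇒hamming≡1 u v p d = flip⇒hamming≡1 u v (p % n) (Diff⇒FlipAt u v p d)

  Diff-sym : ∀ {u v p} → Diff u v p → Diff v u p
  Diff-sym {u} {v} {p} (diff b c) = diff (trans (sym (BoolP.not-involutive (at u p))) (cong not (sym b))) (λ i q → sym (c i q))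

  Diff-position : ∀ {u v p q} → Diff u v p → Diff u v q → p ≈ q
  Diff-position {u} {v} {p} {q} (diff b c) (diff b' c') with ≈-dec p q
  ... | yes r = r
  ... | no r = ⊥-elim (BoolP.not-¬ refl (trans (sym (c' p r)) b))

  Diff-target : ∀ {u v w p} → Diff u v p → Diff u w p → v ≡ w
  Diff-target {u} {v} {w} {p} (diff b c) (diff b' c') = at-ext v w same
    where
    same : ∀ i → at v i ≡ at w i
    same i with ≈-dec i p
    ... | yes r = trans (at-cong v r) (trans b (trans (sym b') (at-cong w (≈-sym r))))
    ... | no r = trans (c i r) (sym (c' i r))

  Diff-cong : ∀ {u v p q} → p ≈ q → Diff u v p → Diff u v q
  Diff-cong {u} {v} {p} {q} r (diff b c) =
    diff (trans (at-cong v (≈-sym r)) (trans b (cong not (at-cong u r)))) (λ i s → c i (λ t → s (≈-trans t r)))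

  toggleLetter : Vec Bool n → ℕ → ℕ → Bool
  toggleLetter u p k = if ⌊ ≈-dec k p ⌋ then not (at u k) else at u k

  toggleLetter-cong : ∀ u p {i j} → i ≈ j → toggleLetter u p i ≡ toggleLetter u p j
  toggleLetter-cong u p {i} {j} r with ≈-dec i p | ≈-dec j p
  ... | yes _ | yes _ = cong not (at-cong u r)
  ... | no _ | no _ = at-cong u r
  ... | yes a | no b = ⊥-elim (b (≈-trans (≈-sym r) a))
  ... | no a | yes b = ⊥-elim (a (≈-trans r b))

  opaque
    toggle : Vec Bool n → ℕ → Vec Bool n
    toggle u p = tabulate (λ k → toggleLetter u p (toℕ k))

    Diff-toggle : ∀ u p → Diff u (toggle u p) p
    Diff-toggle u p = diff
      (trans (at-tabulate (toggleLetter u p) (toggleLetter-cong u p) p) (at-p (≈-dec p p)))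
      (λ i r → trans (at-tabulate (toggleLetter u p) (toggleLetter-cong u p) i) (elsewhere (≈-dec i p) r))
      where
      at-p : (d : Dec (p ≈ p)) → (if ⌊ d ⌋ then not (at u p) else at u p) ≡ not (at u p)
      at-p (yes _) = refl
      at-p (no p≉p) = ⊥-elim (p≉p ≈-refl)
      elsewhere : ∀ {i} (d : Dec (i ≈ p)) → ¬ (i ≈ p) → (if ⌊ d ⌋ then not (at u i) else at u i) ≡ at u i
      elsewhere (yes i≈p) i≉p = ⊥-elim (i≉p i≈p)
      elsewhere (no _) _ = refl

  Diff⇒toggle : ∀ {u v p} → Diff u v p → v ≡ toggle u p
  Diff⇒toggle {u} d = Diff-target {u} d (Diff-toggle u _)

  at-toggle≈ : ∀ u p i → i ≈ p → at (toggle u p) i ≡ not (at u i)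
  at-toggle≈ u p i r = trans (at-cong (toggle u p) r) (trans (flipped (Diff-toggle u p)) (cong not (at-cong u (≈-sym r))))

  at-toggle≉ : ∀ u p i → ¬ (i ≈ p) → at (toggle u p) i ≡ at u i
  at-toggle≉ u p i r = unchanged (Diff-toggle u p) i r

  toggle-cong : ∀ u {p q} → p ≈ q → toggle u p ≡ toggle u q
  toggle-cong u {p} {q} r = sym (Diff⇒toggle {u} (Diff-cong {u} (≈-sym r) (Diff-toggle u q)))

  toggle-involutive : ∀ u p → toggle (toggle u p) p ≡ u
  toggle-involutive u p = sym (Diff⇒toggle {toggle u p} {u} {p} (Diff-sym {u} (Diff-toggle u p)))

  -- Dihedral maps u ↦ (i ↦ u (a + c·i)), where c ∈ {1, N} is a sign modulo n.
  data Sign : ℕ → Set where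
    plus : Sign 1
    minus : Sign N

  sign²≈1 : ∀ {c} → Sign c → c * c ≈ 1
  sign²≈1 plus = ≈-refl
  sign²≈1 minus = N*N≈1

  sign²· : ∀ {c} → Sign c → ∀ x → (c * c) * x ≈ x
  sign²· s x = ≈-trans (*-cong (sign²≈1 s) (≈-refl {x})) (≡⇒≈ (*-identityˡ x))

  sign-cancel : ∀ {c x y} → Sign c → c * x ≈ c * y → x ≈ y
  sign-cancel {c} {x} {y} s r = begin
    x            ≈⟨ ≈-sym (sign²· s x) ⟩
    c * c * x    ≈⟨ ≡⇒≈ (*-assoc c c x) ⟩
    c * (c * x)  ≈⟨ *-cong (≈-refl {c}) r ⟩
    c * (c * y)  ≈⟨ ≡⇒≈ (sym (*-assoc c c y)) ⟩
    c * c * y    ≈⟨ sign²· s y ⟩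
    y            ∎
    where open ≈-Reasoning

  opaque
    dihedral : ℕ → ℕ → Vec Bool n → Vec Bool n
    dihedral a c u = tabulate (λ k → at u (a + c * toℕ k))

    at-dihedral : ∀ a c u i → at (dihedral a c u) i ≡ at u (a + c * i)
    at-dihedral a c u i = at-tabulate (λ k → at u (a + c * k)) (λ r → at-cong u (+-cong (≈-refl {a}) (*-cong (≈-refl {c}) r))) i

  dihedral-lucas : ∀ {c} → Sign c → ∀ a u → CyclicLucas u → CyclicLucas (dihedral a c u)
  dihedral-lucas plus a u h i = begin
    at (dihedral a 1 u) i ∧ at (dihedral a 1 u) (suc i)   ≡⟨ cong₂ _∧_ (at-dihedral a 1 u i) (at-dihedral a 1 u (suc i)) ⟩
    at u (a + 1 * i) ∧ at u (a + 1 * suc i)               ≡⟨ cong₂ (λ x y → at u x ∧ at u y) (shift a i) (trans (shift a (suc i)) (+-suc a i)) ⟩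
    at u (a + i) ∧ at u (suc (a + i))                     ≡⟨ h (a + i) ⟩
    false                                                 ∎
    where
    open ≡-Reasoning
    shift : ∀ a i → a + 1 * i ≡ a + i
    shift = solve-∀
  dihedral-lucas minus a u h i = begin
    at (dihedral a N u) i ∧ at (dihedral a N u) (suc i)   ≡⟨ cong₂ _∧_ (at-dihedral a N u i) (at-dihedral a N u (suc i)) ⟩
    at u (a + N * i) ∧ at u j                             ≡⟨ cong (_∧ at u j) (at-cong u step) ⟩
    at u (suc j) ∧ at u j                                 ≡⟨ BoolP.∧-comm (at u (suc j)) (at u j) ⟩
    at u j ∧ at u (suc j)                                 ≡⟨ h j ⟩
    false                                                 ∎
    where
    open ≡-Reasoning
    j : ℕ
    j = a + N * suc i
    step : a + N * i ≈ suc j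
    step = ≈-sym (≈-trans (≡⇒≈ (expand a N i)) (+≈0 {a + N * i} n≈0))
      where
      expand : ∀ a N i → suc (a + N * suc i) ≡ a + N * i + suc N
      expand = solve-∀

  inverse-shift : ℕ → ℕ → ℕ
  inverse-shift a c = c * (N * a)

  dihedral-inverseˡ : ∀ {c} → Sign c → ∀ a u → dihedral (inverse-shift a c) c (dihedral a c u) ≡ u
  dihedral-inverseˡ {c} s a u = at-ext _ u λ i →
    trans (at-dihedral (inverse-shift a c) c (dihedral a c u) i)
          (trans (at-dihedral a c u (inverse-shift a c + c * i)) (at-cong u (cancels i)))
    where
    expand : ∀ a c a' i → a + c * (c * a' + c * i) ≡ (a + (c * c) * a') + (c * c) * i
    expand = solve-∀
    cancels : ∀ i → a + c * (inverse-shift a c + c * i) ≈ i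
    cancels i = ≈-trans (≡⇒≈ (expand a c (N * a) i))
      (≈-trans (+-cong (+-cong (≈-refl {a}) (sign²· s (N * a))) (sign²· s i)) (+-cong (+-inverse a) (≈-refl {i})))

  dihedral-inverseʳ : ∀ {c} → Sign c → ∀ a u → dihedral a c (dihedral (inverse-shift a c) c u) ≡ u
  dihedral-inverseʳ {c} s a u = at-ext _ u λ i →
    trans (at-dihedral a c (dihedral (inverse-shift a c) c u) i)
          (trans (at-dihedral (inverse-shift a c) c u (a + c * i)) (at-cong u (cancels i)))
    where
    expand : ∀ c x a i → c * x + c * (a + c * i) ≡ c * (x + a) + (c * c) * i
    expand = solve-∀
    cancels : ∀ i → inverse-shift a c + c * (a + c * i) ≈ i
    cancels i = ≈-trans (≡⇒≈ (expand c (N * a) a i))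
      (≈-trans (+-cong (*-cong (≈-refl {c}) (≈-trans (≡⇒≈ (+-comm (N * a) a)) (+-inverse a))) (sign²· s i))
               (≡⇒≈ (cong (_+ i) (*-zeroʳ c))))

  -- the position that `dihedral a c` moves to p
  preimage : ℕ → ℕ → ℕ → ℕ
  preimage a c p = c * (p + N * a)

  preimage-correct : ∀ {c} → Sign c → ∀ a p → a + c * preimage a c p ≈ p
  preimage-correct {c} s a p = begin
    a + c * (c * (p + N * a))   ≈⟨ +-cong (≈-refl {a}) (≈-trans (≡⇒≈ (sym (*-assoc c c (p + N * a)))) (sign²· s (p + N * a))) ⟩
    a + (p + N * a)             ≈⟨ ≡⇒≈ (rearrange a p N) ⟩
    p + n * a                   ≈⟨ +≈0 {p} (≈-trans (≡⇒≈ (*-comm n a)) (*n≈0 a)) ⟩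
    p                           ∎
    where
    open ≈-Reasoning
    rearrange : ∀ a p N → a + (p + N * a) ≡ p + suc N * a
    rearrange = solve-∀

  preimage-unique : ∀ {c} → Sign c → ∀ a p i → a + c * i ≈ p → i ≈ preimage a c p
  preimage-unique {c} s a p i r = begin
    i                                 ≈⟨ ≈-sym (sign²· s i) ⟩
    c * c * i                         ≡⟨⟩
    0 + c * c * i                     ≈⟨ +-cong (≈-sym vanishes) (≈-refl {c * c * i}) ⟩
    c * (a + N * a) + c * c * i       ≡⟨ rearrange c a i (N * a) ⟩
    c * (a + c * i) + c * (N * a)     ≈⟨ +-cong (*-cong (≈-refl {c}) r) (≈-refl {c * (N * a)}) ⟩
    c * p + c * (N * a)               ≡⟨ *-distribˡ-+ c p (N * a) ⟨
    c * (p + N * a)                   ∎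
    where
    open ≈-Reasoning
    vanishes : c * (a + N * a) ≈ 0
    vanishes = ≈-trans (*-cong (≈-refl {c}) (+-inverse a)) (≡⇒≈ (*-zeroʳ c))
    rearrange : ∀ c a i x → c * (a + x) + c * c * i ≡ c * (a + c * i) + c * x
    rearrange = solve-∀

  dihedral-Diff : ∀ {c} → Sign c → ∀ a {u v p} → Diff u v p → Diff (dihedral a c u) (dihedral a c v) (preimage a c p)
  dihedral-Diff {c} s a {u} {v} {p} (diff b d) = diff
    (trans (at-dihedral a c v _) (trans (at-cong v (preimage-correct s a p))
      (trans b (cong not (trans (at-cong u (≈-sym (preimage-correct s a p))) (sym (at-dihedral a c u _)))))))
    (λ i r → trans (at-dihedral a c v i) (trans (d (a + c * i) (λ t → r (preimage-unique s a p i t))) (sym (at-dihedral a c u i))))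

  lucas : (x : V n) → CyclicLucas (proj₁ x)
  lucas (u , t) = isLucas⇒cyclic u t

  vertex : (u : Vec Bool n) → CyclicLucas u → V n
  vertex u h = u , cyclic⇒isLucas u h

  opaque
    Adj⇒Diff : ∀ (x y : V n) → Adj x y → Σ ℕ λ p → p < n × Diff (proj₁ x) (proj₁ y) p
    Adj⇒Diff x y = hamming≡1⇒Diff (proj₁ x) (proj₁ y)

  Diff⇒Adj : ∀ (x y : V n) p → Diff (proj₁ x) (proj₁ y) p → Adj x y
  Diff⇒Adj x y p = Diff⇒hamming≡1 (proj₁ x) (proj₁ y) p

  Adj-sym : ∀ (x y : V n) → Adj x y → Adj y x
  Adj-sym x y h with Adj⇒Diff x y h
  ... | p , _ , d = Diff⇒Adj y x p (Diff-sym {proj₁ x} d)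

  dihedralV : ∀ {c} → Sign c → ℕ → V n → V n
  dihedralV s a x = vertex (dihedral a _ (proj₁ x)) (dihedral-lucas s a (proj₁ x) (lucas x))

  dihedralV-adj : ∀ {c} (s : Sign c) a (x y : V n) → Adj x y → Adj (dihedralV s a x) (dihedralV s a y)
  dihedralV-adj s a x y h with Adj⇒Diff x y h
  ... | p , _ , d = Diff⇒Adj (dihedralV s a x) (dihedralV s a y) _ (dihedral-Diff s a {proj₁ x} {proj₁ y} d)

  dihedralAut : ∀ {c} → Sign c → ℕ → Aut n
  dihedralAut {c} s a = record
    { perm = mk↔ₛ′ (dihedralV s a) (dihedralV s (inverse-shift a c))
        (λ y → vertex-≡ (dihedral-inverseʳ s a (proj₁ y))) undo
    ; preserve = λ x y → mk⇔ (dihedralV-adj s a x y) (λ h →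
        subst₂ Adj (undo x) (undo y) (dihedralV-adj s (inverse-shift a c) (dihedralV s a x) (dihedralV s a y) h)) }
    where
    undo : ∀ x → dihedralV s (inverse-shift a c) (dihedralV s a x) ≡ x
    undo x = vertex-≡ (dihedral-inverseˡ s a (proj₁ x))

  zeroString : Vec Bool n
  zeroString = replicate n false

  at-zero : ∀ i → at zeroString i ≡ false
  at-zero = at-replicate false

  zeroV : V n
  zeroV = vertex zeroString (λ i → cong (_∧ at zeroString (suc i)) (at-zero i))

  zero-or-one : (x : V n) → x ≡ zeroV ⊎ ∃ λ i → at (proj₁ x) i ≡ true
  zero-or-one x with FinP.any? (λ (i : Fin n) → at (proj₁ x) (toℕ i) BoolP.≟ true)
  ... | yes (i , e) = inj₂ (toℕ i , e)
  ... | no none = inj₁ (vertex-≡ (at-ext (proj₁ x) zeroString (λ i → trans (all-false i (at (proj₁ x) i) refl) (sym (at-zero i)))))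
    where
    all-false : ∀ i b → at (proj₁ x) i ≡ b → b ≡ false
    all-false i false _ = refl
    all-false i true e = ⊥-elim (none (i mod n , trans (at-cong (proj₁ x) (≈-trans (≡⇒≈ (FinP.toℕ-fromℕ< (m%n<n i n))) (%≈ i))) e))

  removeOne : (x : V n) (p : ℕ) → at (proj₁ x) p ≡ true → V n
  removeOne x p e = vertex (toggle (proj₁ x) p) (lucas-below (proj₁ x) (toggle (proj₁ x) p) (lucas x) fewer)
    where
    fewer : ∀ i → at (toggle (proj₁ x) p) i ≡ true → at (proj₁ x) i ≡ true
    fewer i e₂ with ≈-dec i p
    ... | yes r = trans (at-cong (proj₁ x) r) e
    ... | no r = trans (sym (at-toggle≉ (proj₁ x) p i r)) e₂

  weight-removeOne : ∀ (x : V n) p (e : at (proj₁ x) p ≡ true) → weight (proj₁ x) ≡ suc (weight (proj₁ (removeOne x p e)))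
  weight-removeOne x p e = weight-flip u (toggle u p) (p % n) (Diff⇒FlipAt u (toggle u p) p (Diff-toggle u p)) (trans (sym (at≡bit u p)) e)
    where
    u : Vec Bool n
    u = proj₁ x

injective⇒surjective : ∀ {k} (f : Fin (suc k) → Fin (suc k)) → (∀ {x y} → f x ≡ f y → x ≡ y) → ∀ y → ∃ λ x → f x ≡ y
injective⇒surjective {k} f f-inj y with FinP.any? (λ x → f x FinP.≟ y)
... | yes hit = hit
... | no miss = ⊥-elim (<-irrefl refl (FinP.injective⇒≤ {f = f'} f'-inj))
  where
  avoids : ∀ x → y ≢ f x
  avoids x e = miss (x , sym e)
  f' : Fin (suc k) → Fin k
  f' x = Fin.punchOut (avoids x)
  f'-inj : ∀ {x z} → f' x ≡ f' z → x ≡ z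
  f'-inj {x} {z} e = f-inj (FinP.punchOut-injective (avoids x) (avoids z) e)

module Automorphisms (N : ℕ) (N≥1 : 1 ≤ N) where
  open Cyclic N

  -- since n ≥ 2, consecutive positions are different
  1≉0 : ¬ (1 ≈ 0)
  1≉0 e = 1≢0 (trans (sym (m<n⇒m%n≡m (s≤s N≥1))) (residue e))
    where
    1≢0 : 1 ≢ 0
    1≢0 ()

  suc≉ : ∀ i → ¬ (suc i ≈ i)
  suc≉ i e = 1≉0 (+-cancelˡ i (≈-trans (≡⇒≈ (+-comm i 1)) (≈-trans e (≡⇒≈ (sym (+-identityʳ i))))))

  unit : ℕ → Vec Bool n
  unit p = toggle zeroString p

  unit-on : ∀ p i → i ≈ p → at (unit p) i ≡ true
  unit-on p i r = trans (at-toggle≈ zeroString p i r) (cong not (at-zero i))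

  unit-off : ∀ p i → ¬ (i ≈ p) → at (unit p) i ≡ false
  unit-off p i r = trans (at-toggle≉ zeroString p i r) (at-zero i)

  unit-true : ∀ p i → at (unit p) i ≡ true → i ≈ p
  unit-true p i e with ≈-dec i p
  ... | yes r = r
  ... | no r = ⊥-elim (BoolP.not-¬ refl (trans (sym (unit-off p i r)) e))

  unitV : ℕ → V n
  unitV p = vertex (unit p) (lucas-by (unit p) (λ i e₁ e₂ → suc≉ i (≈-trans (unit-true p (suc i) e₂) (≈-sym (unit-true p i e₁)))))

  zero-unit-adj : ∀ p → Adj zeroV (unitV p)
  zero-unit-adj p = Diff⇒Adj zeroV (unitV p) p (Diff-toggle zeroString p)

  unitV-cong : ∀ {p q} → p ≈ q → unitV p ≡ unitV q
  unitV-cong r = vertex-≡ (toggle-cong zeroString r)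

  unitV-injective : ∀ {p q} → unitV p ≡ unitV q → p ≈ q
  unitV-injective {p} {q} e =
    Diff-position {zeroString} (Diff-toggle zeroString p) (subst (λ w → Diff zeroString w q) (sym (cong proj₁ e)) (Diff-toggle zeroString q))

  pair : ℕ → ℕ → Vec Bool n
  pair p q = toggle (unit p) q

  pair-lucas : ∀ p q → ¬ (p ≈ q) → ¬ (q ≈ suc p) → ¬ (suc q ≈ p) → CyclicLucas (pair p q)
  pair-lucas p q p≉q q≉p+1 q+1≉p = lucas-by (pair p q) (λ i e₁ e₂ → apart i (ones i e₁) (ones (suc i) e₂))
    where
    ones : ∀ i → at (pair p q) i ≡ true → i ≈ p ⊎ i ≈ q
    ones i e with ≈-dec i q
    ... | yes r = inj₂ r
    ... | no r = inj₁ (unit-true p i (trans (sym (at-toggle≉ (unit p) q i r)) e))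
    apart : ∀ i → (i ≈ p ⊎ i ≈ q) → (suc i ≈ p ⊎ suc i ≈ q) → ⊥
    apart i (inj₁ a) (inj₁ b) = suc≉ i (≈-trans b (≈-sym a))
    apart i (inj₂ a) (inj₂ b) = suc≉ i (≈-trans b (≈-sym a))
    apart i (inj₁ a) (inj₂ b) = q≉p+1 (≈-trans (≈-sym b) (+-cong (≈-refl {1}) a))
    apart i (inj₂ a) (inj₁ b) = q+1≉p (≈-trans (+-cong (≈-refl {1}) (≈-sym a)) b)

  pair-Diff : ∀ p q → ¬ (p ≈ q) → Diff (unit q) (pair p q) p
  pair-Diff p q p≉q = diff (trans at-p (cong not (sym (unit-off q p p≉q)))) same
    where
    at-p : at (pair p q) p ≡ true
    at-p = trans (at-toggle≉ (unit p) q p p≉q) (unit-on p p ≈-refl)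
    at-q : at (pair p q) q ≡ true
    at-q = trans (at-toggle≈ (unit p) q q ≈-refl) (cong not (unit-off p q (λ r → p≉q (≈-sym r))))
    same : ∀ i → ¬ (i ≈ p) → at (pair p q) i ≡ at (unit q) i
    same i r with ≈-dec i q
    ... | yes s = trans (at-cong (pair p q) s) (trans at-q (sym (unit-on q i s)))
    ... | no s = trans (at-toggle≉ (unit p) q i s) (trans (unit-off p i r) (sym (unit-off q i s)))

  two-ones : ∀ (v : V n) i → at (proj₁ v) i ≡ true → at (proj₁ v) (suc i) ≡ true → ⊥
  two-ones v i a b = BoolP.not-¬ refl (trans (sym (cong₂ _∧_ a b)) (lucas v i))

  module UnitImages (g : Aut n) where

    private
      neighbour : ∀ j → Σ ℕ λ p → p < n × Diff (proj₁ (act g zeroV)) (proj₁ (act g (unitV j))) p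
      neighbour j = Adj⇒Diff (act g zeroV) (act g (unitV j)) (adj-preserved g zeroV (unitV j) (zero-unit-adj j))

    -- g(e_j) differs from g(0) at position σ j
    σ : ℕ → ℕ
    σ j = proj₁ (neighbour j)

    σ<n : ∀ j → σ j < n
    σ<n j = proj₁ (proj₂ (neighbour j))

    σ-Diff : ∀ j → Diff (proj₁ (act g zeroV)) (proj₁ (act g (unitV j))) (σ j)
    σ-Diff j = proj₂ (proj₂ (neighbour j))

    σ-injective : ∀ {j k} → σ j ≈ σ k → j ≈ k
    σ-injective {j} {k} r = unitV-injective (act-injective g (vertex-≡
      (Diff-target {proj₁ (act g zeroV)} (σ-Diff j) (Diff-cong {proj₁ (act g zeroV)} (≈-sym r) (σ-Diff k)))))

    σ-surjective : ∀ i → ∃ λ j → σ j ≈ i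
    σ-surjective i = toℕ j , ≈-trans (≡⇒≈ (trans (sym (FinP.toℕ-fromℕ< (σ<n (toℕ j))))
                                       (trans (cong toℕ hit) (FinP.toℕ-fromℕ< (m%n<n i n))))) (%≈ i)
      where
      σᶠ : Fin n → Fin n
      σᶠ j = fromℕ< (σ<n (toℕ j))
      σᶠ-injective : ∀ {j k} → σᶠ j ≡ σᶠ k → j ≡ k
      σᶠ-injective {j} {k} e = FinP.toℕ-injective (<n⇒≡ (FinP.toℕ<n j) (FinP.toℕ<n k) (σ-injective (≡⇒≈
        (trans (sym (FinP.toℕ-fromℕ< (σ<n (toℕ j)))) (trans (cong toℕ e) (FinP.toℕ-fromℕ< (σ<n (toℕ k))))))))
      found : ∃ λ j → σᶠ j ≡ i mod n
      found = injective⇒surjective σᶠ σᶠ-injective (i mod n)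
      j : Fin n
      j = proj₁ found
      hit : σᶠ j ≡ i mod n
      hit = proj₂ found

    -- g(0) has no one: a one at i would give g(e_j), for σ j ≈ i + 1, ones at i and i + 1
    fixes-zero : act g zeroV ≡ zeroV
    fixes-zero with zero-or-one (act g zeroV)
    ... | inj₁ e = e
    ... | inj₂ (i , one-at-i) = ⊥-elim (two-ones w i (trans (unchanged D i (λ r → suc≉ i (≈-sym r))) one-at-i)
                                                      (trans (flipped D) (cong not zero-at-i+1)))
      where
      u : V n
      u = act g zeroV
      zero-at-i+1 : at (proj₁ u) (suc i) ≡ false
      zero-at-i+1 = trans (sym (cong (_∧ at (proj₁ u) (suc i)) one-at-i)) (lucas u i)
      j : ℕ
      j = proj₁ (σ-surjective (suc i))
      w : V n
      w = act g (unitV j)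
      D : Diff (proj₁ u) (proj₁ w) (suc i)
      D = Diff-cong {proj₁ u} (proj₂ (σ-surjective (suc i))) (σ-Diff j)

    act-unit : ∀ j → act g (unitV j) ≡ unitV (σ j)
    act-unit j = vertex-≡ (Diff⇒toggle {zeroString} (subst (λ z → Diff (proj₁ z) (proj₁ (act g (unitV j))) (σ j)) fixes-zero (σ-Diff j)))

    one-at : ∀ (W v : V n) → act g v ≡ W → (v ≡ zeroV → ⊥) → ∀ k r → Diff (unit (σ k)) (proj₁ W) r → at (proj₁ v) k ≡ true
    one-at W v gv≡W v≢0 k r D = from-Diff (Adj⇒Diff (unitV k) v adjacent)
      where
      adjacent : Adj (unitV k) v
      adjacent = adj-reflected g (unitV k) v (subst₂ (Adj {n}) (sym (act-unit k)) (sym gv≡W) (Diff⇒Adj (unitV (σ k)) W r D))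
      from-Diff : (Σ ℕ λ s → s < n × Diff (unit k) (proj₁ v) s) → at (proj₁ v) k ≡ true
      from-Diff (s , _ , E) with ≈-dec s k
      ... | no s≉k = trans (unchanged E k (λ z → s≉k (≈-sym z))) (unit-on k k ≈-refl)
      ... | yes s≈k = ⊥-elim (v≢0 (vertex-≡ (trans (Diff⇒toggle {unit k} (Diff-cong {unit k} s≈k E)) (toggle-involutive zeroString k))))

    -- σ(j+1) ≈ σ(j) ± 1: otherwise e_σ(j) + e_σ(j+1) is a vertex whose
    -- preimage has ones at j and j + 1
    no-jump : ∀ j → ¬ (σ (suc j) ≈ suc (σ j)) → ¬ (suc (σ (suc j)) ≈ σ j) → ⊥
    no-jump j r₁ r₂ = two-ones v j (one-at W v gv≡W v≢0 j q (Diff-toggle (unit p) q))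
                                  (one-at W v gv≡W v≢0 (suc j) p (pair-Diff p q p≉q))
      where
      p q : ℕ
      p = σ j
      q = σ (suc j)
      p≉q : ¬ (p ≈ q)
      p≉q r = suc≉ j (≈-sym (σ-injective r))
      W : V n
      W = vertex (pair p q) (pair-lucas p q p≉q r₁ r₂)
      v : V n
      v = inv g W
      gv≡W : act g v ≡ W
      gv≡W = act-inv g W
      v≢0 : v ≡ zeroV → ⊥
      v≢0 v≡0 = BoolP.not-¬ refl (begin
        false                     ≡⟨ at-zero p ⟨
        at zeroString p           ≡⟨ cong (λ z → at (proj₁ z) p) (trans (sym fixes-zero) (cong (act g) (sym v≡0))) ⟩
        at (proj₁ (act g v)) p    ≡⟨ cong (λ z → at (proj₁ z) p) gv≡W ⟩
        at (pair p q) p           ≡⟨ at-toggle≉ (unit p) q p p≉q ⟩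
        at (unit p) p             ≡⟨ unit-on p p ≈-refl ⟩
        true                      ∎)
        where open ≡-Reasoning

    σ-step : ∀ j → σ (suc j) ≈ suc (σ j) ⊎ suc (σ (suc j)) ≈ σ j
    σ-step j = decide (≈-dec (σ (suc j)) (suc (σ j))) (≈-dec (suc (σ (suc j))) (σ j))
      where
      decide : Dec (σ (suc j) ≈ suc (σ j)) → Dec (suc (σ (suc j)) ≈ σ j) → σ (suc j) ≈ suc (σ j) ⊎ suc (σ (suc j)) ≈ σ j
      decide (yes r) _ = inj₁ r
      decide (no _) (yes r) = inj₂ r
      decide (no r₁) (no r₂) = ⊥-elim (no-jump j r₁ r₂)

  signs-agree-or-cancel : ∀ {c c'} → Sign c → Sign c' → c ≡ c' ⊎ (c + c' ≈ 0 × ¬ (2 ≈ 0))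
  signs-agree-or-cancel plus plus = inj₁ refl
  signs-agree-or-cancel minus minus = inj₁ refl
  signs-agree-or-cancel plus minus with N ≟ 1
  ... | yes N≡1 = inj₁ (sym N≡1)
  ... | no N≢1 = inj₂ (n≈0 , 2≉0 N≢1)
    where
    2≉0 : N ≢ 1 → ¬ (2 ≈ 0)
    2≉0 N≢1 e = 2≢0 (trans (sym (m<n⇒m%n≡m (s≤s (≤∧≢⇒< N≥1 (λ z → N≢1 (sym z)))))) (residue e))
      where
      2≢0 : 2 ≢ 0
      2≢0 ()
  signs-agree-or-cancel minus plus with signs-agree-or-cancel plus minus
  ... | inj₁ 1≡N = inj₁ (sym 1≡N)
  ... | inj₂ (cancel , 2≉0) = inj₂ (≈-trans (≡⇒≈ (+-comm N 1)) cancel , 2≉0)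

  dihedral-zero : ∀ a c → dihedral a c zeroString ≡ zeroString
  dihedral-zero a c = at-ext _ zeroString (λ i → trans (at-dihedral a c zeroString i) (trans (at-zero _) (sym (at-zero i))))

  dihedral-unit : ∀ {c} → Sign c → ∀ a p → dihedral a c (unit p) ≡ unit (preimage a c p)
  dihedral-unit {c} s a p = trans (Diff⇒toggle {dihedral a c zeroString} (dihedral-Diff s a {zeroString} {unit p} (Diff-toggle zeroString p)))
                                  (cong (λ z → toggle z (preimage a c p)) (dihedral-zero a c))

  module Normalise (g : Aut n) where
    open UnitImages g

    step : ∀ j → Σ ℕ λ c → Sign c × σ (suc j) ≈ σ j + c
    step j = from-step (σ-step j)
      where
      from-step : σ (suc j) ≈ suc (σ j) ⊎ suc (σ (suc j)) ≈ σ j → Σ ℕ λ c → Sign c × σ (suc j) ≈ σ j + c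
      from-step (inj₁ r) = 1 , plus , ≈-trans r (≡⇒≈ (+-comm 1 (σ j)))
      from-step (inj₂ r) = N , minus , (begin
        σ (suc j)              ≈⟨ ≈-sym (+≈0 {σ (suc j)} n≈0) ⟩
        σ (suc j) + suc N      ≡⟨ +-suc (σ (suc j)) N ⟩
        suc (σ (suc j)) + N    ≈⟨ +-cong r (≈-refl {N}) ⟩
        σ j + N                ∎)
        where open ≈-Reasoning

    c : ℕ
    c = proj₁ (step 0)

    sign : Sign c
    sign = proj₁ (proj₂ (step 0))

    a : ℕ
    a = σ 0

    AffineAt : ℕ → Set
    AffineAt j = σ j ≈ a + c * j × σ (suc j) ≈ a + c * suc j

    affine-0 : AffineAt 0
    affine-0 = ≡⇒≈ (sym (trans (cong (a +_) (*-zeroʳ c)) (+-identityʳ a))) ,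
               ≈-trans (proj₂ (proj₂ (step 0))) (≡⇒≈ (cong (a +_) (sym (*-identityʳ c))))

    -- the next step has the same sign: opposite signs would give σ (j + 2) ≈ σ j
    affine-suc : ∀ j → AffineAt j → AffineAt (suc j)
    affine-suc j (at-j , at-j+1) = at-j+1 , continue (signs-agree-or-cancel sign sign')
      where
      c' : ℕ
      c' = proj₁ (step (suc j))
      sign' : Sign c'
      sign' = proj₁ (proj₂ (step (suc j)))
      σ-j+2 : σ (suc (suc j)) ≈ a + c * suc j + c'
      σ-j+2 = ≈-trans (proj₂ (proj₂ (step (suc j)))) (+-cong at-j+1 (≈-refl {c'}))
      continue : c ≡ c' ⊎ (c + c' ≈ 0 × ¬ (2 ≈ 0)) → σ (suc (suc j)) ≈ a + c * suc (suc j)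
      continue (inj₁ c≡c') = ≈-trans σ-j+2 (≡⇒≈ (trans (cong (a + c * suc j +_) (sym c≡c')) (expand a c j)))
        where
        expand : ∀ a c j → a + c * suc j + c ≡ a + c * suc (suc j)
        expand = solve-∀
      continue (inj₂ (cancel , 2≉0)) =
        ⊥-elim (2≉0 (+-cancelˡ j (≈-trans (≡⇒≈ (+-comm j 2)) (≈-trans (σ-injective back) (≡⇒≈ (sym (+-identityʳ j)))))))
        where
        regroup : ∀ a c j c' → a + c * suc j + c' ≡ (a + c * j) + (c + c')
        regroup = solve-∀
        back : σ (suc (suc j)) ≈ σ j
        back = begin
          σ (suc (suc j))             ≈⟨ σ-j+2 ⟩
          a + c * suc j + c'          ≡⟨ regroup a c j c' ⟩
          a + c * j + (c + c')        ≈⟨ +≈0 {a + c * j} cancel ⟩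
          a + c * j                   ≈⟨ ≈-sym at-j ⟩
          σ j                         ∎
          where open ≈-Reasoning

    σ-affine : ∀ j → σ j ≈ a + c * j
    σ-affine j = proj₁ (affine j)
      where
      affine : ∀ j → AffineAt j
      affine zero = affine-0
      affine (suc j) = affine-suc j (affine j)

    normalised : Aut n
    normalised = dihedralAut sign a ∘ᴬ g

    normalised-zero : act normalised zeroV ≡ zeroV
    normalised-zero = trans (cong (act (dihedralAut sign a)) fixes-zero) (vertex-≡ (dihedral-zero a c))

    normalised-unit : ∀ j → act normalised (unitV j) ≡ unitV j
    normalised-unit j = trans (cong (act (dihedralAut sign a)) (act-unit j))
      (trans (vertex-≡ (dihedral-unit sign a (σ j))) (unitV-cong (≈-sym (preimage-unique sign a (σ j) j (≈-sym (σ-affine j))))))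

  common-neighbours : ∀ u p q y r s → ¬ (p ≈ q) → Diff (toggle u p) y r → Diff (toggle u q) y s →
    y ≡ u ⊎ y ≡ toggle (toggle u p) q
  common-neighbours u p q y r s p≉q D₁ D₂ with ≈-dec r p | ≈-dec r q
  ... | yes r≈p | _ = inj₁ (Diff-target {toggle u p} (Diff-cong {toggle u p} r≈p D₁) (Diff-sym {u} (Diff-toggle u p)))
  ... | no _ | yes r≈q = inj₂ (Diff-target {toggle u p} (Diff-cong {toggle u p} r≈q D₁) (Diff-toggle (toggle u p) q))
  ... | no r≉p | no r≉q with ≈-dec r s
  ...   | no r≉s = ⊥-elim (BoolP.not-¬ refl (begin
          at u r                  ≡⟨ at-toggle≉ u q r r≉q ⟨
          at (toggle u q) r       ≡⟨ unchanged D₂ r r≉s ⟨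
          at y r                  ≡⟨ flipped D₁ ⟩
          not (at (toggle u p) r) ≡⟨ cong not (at-toggle≉ u p r r≉p) ⟩
          not (at u r)            ∎))
    where open ≡-Reasoning
  ...   | yes r≈s = ⊥-elim (BoolP.not-¬ refl (begin
          at u p                  ≡⟨ at-toggle≉ u q p p≉q ⟨
          at (toggle u q) p       ≡⟨ unchanged D₂ p (λ p≈s → r≉p (≈-trans r≈s (≈-sym p≈s))) ⟨
          at y p                  ≡⟨ unchanged D₁ p (λ p≈r → r≉p (≈-sym p≈r)) ⟩
          at (toggle u p) p       ≡⟨ at-toggle≈ u p p ≈-refl ⟩
          not (at u p)            ∎))
    where open ≡-Reasoning

  module Rigid (h : Aut n) (h-zero : act h zeroV ≡ zeroV) (h-unit : ∀ j → act h (unitV j) ≡ unitV j) where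

    image-beside-fixed : ∀ (x A : V n) p → Diff (proj₁ x) (proj₁ A) p → act h A ≡ A → Σ ℕ λ r → Diff (proj₁ A) (proj₁ (act h x)) r
    image-beside-fixed x A p D hA = forget-bound (Adj⇒Diff A (act h x) (Adj-sym (act h x) A
                                      (subst (Adj (act h x)) hA (adj-preserved h x A (Diff⇒Adj x A p D)))))
      where
      forget-bound : (Σ ℕ λ r → r < n × Diff (proj₁ A) (proj₁ (act h x)) r) → Σ ℕ λ r → Diff (proj₁ A) (proj₁ (act h x)) r
      forget-bound (r , _ , E) = r , E

    -- x with ones at p ≉ q: if h fixes A = x - e_p, B = x - e_q and
    -- C = x - e_p - e_q then h fixes x, since h x is a common neighbour of A
    -- and B different from C
    module TwoOnes (x : V n) (p : ℕ) (x-p : at (proj₁ x) p ≡ true) (q : ℕ)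
                   (A-q : at (proj₁ (removeOne x p x-p)) q ≡ true) where
      u : Vec Bool n
      u = proj₁ x

      A : V n
      A = removeOne x p x-p

      q≉p : ¬ (q ≈ p)
      q≉p q≈p = BoolP.not-¬ refl (begin
        false                    ≡⟨ cong not x-p ⟨
        not (at u p)             ≡⟨ at-toggle≈ u p p ≈-refl ⟨
        at (proj₁ A) p           ≡⟨ at-cong (proj₁ A) q≈p ⟨
        at (proj₁ A) q           ≡⟨ A-q ⟩
        true                     ∎)
        where open ≡-Reasoning

      x-q : at u q ≡ true
      x-q = trans (sym (at-toggle≉ u p q q≉p)) A-q

      B C : V n
      B = removeOne x q x-q
      C = removeOne A q A-q

      fixed : act h A ≡ A → act h B ≡ B → act h C ≡ C → act h x ≡ x
      fixed hA hB hC = from-neighbours (image-beside-fixed x A p (Diff-toggle u p) hA) (image-beside-fixed x B q (Diff-toggle u q) hB)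
        where
        not-C : proj₁ (act h x) ≡ proj₁ C → ⊥
        not-C hx≡C = BoolP.not-¬ refl (begin
          at u p                     ≡⟨ cong (λ z → at (proj₁ z) p) (act-injective h (trans (vertex-≡ hx≡C) (sym hC))) ⟩
          at (proj₁ C) p             ≡⟨ at-toggle≉ (proj₁ A) q p (λ p≈q → q≉p (≈-sym p≈q)) ⟩
          at (proj₁ A) p             ≡⟨ at-toggle≈ u p p ≈-refl ⟩
          not (at u p)               ∎)
          where open ≡-Reasoning
        from-neighbours : (Σ ℕ λ r → Diff (proj₁ A) (proj₁ (act h x)) r) → (Σ ℕ λ s → Diff (proj₁ B) (proj₁ (act h x)) s) → act h x ≡ x
        from-neighbours (r , DA) (s , DB) with common-neighbours u p q (proj₁ (act h x)) r s (λ p≈q → q≉p (≈-sym p≈q)) DA DB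
        ... | inj₁ hx≡x = vertex-≡ hx≡x
        ... | inj₂ hx≡C = ⊥-elim (not-C hx≡C)

    fixed-up-to : ∀ k (x : V n) → weight (proj₁ x) ≤ k → act h x ≡ x
    fixed-nonzero : ∀ k (x : V n) p (x-p : at (proj₁ x) p ≡ true) → weight (proj₁ x) ≤ k →
      removeOne x p x-p ≡ zeroV ⊎ (∃ λ q → at (proj₁ (removeOne x p x-p)) q ≡ true) → act h x ≡ x

    fixed-up-to k x w≤k = by-cases (zero-or-one x)
      where
      by-cases : x ≡ zeroV ⊎ (∃ λ p → at (proj₁ x) p ≡ true) → act h x ≡ x
      by-cases (inj₁ refl) = h-zero
      by-cases (inj₂ (p , x-p)) = fixed-nonzero k x p x-p w≤k (zero-or-one (removeOne x p x-p))

    fixed-nonzero zero x p x-p w≤0 _ with () ← subst (_≤ 0) (weight-removeOne x p x-p) w≤0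
    fixed-nonzero (suc k) x p x-p w≤k+1 (inj₁ A≡0) = trans (cong (act h) x≡e_p) (trans (h-unit p) (sym x≡e_p))
      where
      x≡e_p : x ≡ unitV p
      x≡e_p = vertex-≡ (trans (sym (toggle-involutive (proj₁ x) p)) (cong (λ z → toggle (proj₁ z) p) A≡0))
    fixed-nonzero (suc k) x p x-p w≤k+1 (inj₂ (q , A-q)) =
      fixed (fixed-up-to k A A≤k) (fixed-up-to k B B≤k) (fixed-up-to k C (≤-trans (n≤1+n _) C<k))
      where
      open TwoOnes x p x-p q A-q
      below : ∀ {a b} → a ≡ suc b → a ≤ suc k → b ≤ k
      below a≡1+b a≤1+k = s≤s⁻¹ (≤-trans (≤-reflexive (sym a≡1+b)) a≤1+k)
      A≤k : weight (proj₁ A) ≤ k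
      A≤k = below (weight-removeOne x p x-p) w≤k+1
      B≤k : weight (proj₁ B) ≤ k
      B≤k = below (weight-removeOne x q x-q) w≤k+1
      C<k : suc (weight (proj₁ C)) ≤ k
      C<k = ≤-trans (≤-reflexive (sym (weight-removeOne A q A-q))) A≤k

    rigid : ∀ (x : V n) → act h x ≡ x
    rigid x = fixed-up-to (weight (proj₁ x)) x ≤-refl

  record IsDihedral (g : Aut n) : Set where
    field
      c : ℕ
      sign : Sign c
      shift : ℕ
      acts-as : ∀ x → act g x ≡ dihedralV sign shift x

  classification : ∀ (g : Aut n) → IsDihedral g
  classification g = record
    { c = c ; sign = sign ; shift = inverse-shift a c
    ; acts-as = λ x → vertex-≡ (trans (sym (dihedral-inverseˡ sign a (proj₁ (act g x))))
                                      (cong (λ z → dihedral (inverse-shift a c) c (proj₁ z)) (rigid x))) }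
    where
    open Normalise g
    open Rigid normalised normalised-zero normalised-unit

module EdgeOrbits (N : ℕ) (N≥1 : 1 ≤ N) where
  open Cyclic N
  open Automorphisms N N≥1

  record Rooted (w : Vec Bool n) : Set where
    constructor rooted
    field
      lucas-w : CyclicLucas w
      root : at w 0 ≡ true
  open Rooted public

  top : ∀ w → Rooted w → V n
  top w rw = vertex w (lucas-w rw)

  bottom : ∀ w → Rooted w → V n
  bottom w rw = removeOne (top w rw) 0 (root rw)

  rootedEdge : ∀ w → Rooted w → Edge n
  rootedEdge w rw = (bottom w rw , top w rw) , Diff⇒Adj (bottom w rw) (top w rw) 0 (Diff-sym {w} (Diff-toggle w 0))

  rootedEdge-irrelevant : ∀ {w w'} (rw : Rooted w) (rw' : Rooted w') (e : Edge n) → w ≡ w' →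
    InOrbit (rootedEdge w rw) e → InOrbit (rootedEdge w' rw') e
  rootedEdge-irrelevant {w} rw rw' e refl (g , s) =
    g , subst₂ (λ a b → SamePair (act g a , act g b) (proj₁ e)) (vertex-≡ refl) (vertex-≡ refl) s

  dihedralE : ∀ {c} → Sign c → ℕ → Edge n → Edge n
  dihedralE s a ((x , y) , h) = (dihedralV s a x , dihedralV s a y) , dihedralV-adj s a x y h

  dihedral-in-orbit : ∀ {c} (s : Sign c) a e → InOrbit e (dihedralE s a e)
  dihedral-in-orbit s a ((x , y) , h) = dihedralAut s a , inj₁ (refl , refl)

  Upward : Vec Bool n → Vec Bool n → ℕ → Set
  Upward x y p = Diff x y p × at y p ≡ true

  upward-rooted : ∀ w → Rooted w → Upward (toggle w 0) w 0
  upward-rooted w rw = Diff-sym {w} (Diff-toggle w 0) , root rw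

  upward-dihedral : ∀ {c} (s : Sign c) a {x y p} → Upward x y p → Upward (dihedral a c x) (dihedral a c y) (preimage a c p)
  upward-dihedral s a {x} {y} {p} (D , y-p) =
    dihedral-Diff s a D , trans (at-dihedral a _ y _) (trans (at-cong y (preimage-correct s a p)) y-p)

  upward-unique : ∀ {x y x' y' : V n} {p p'} → Upward (proj₁ x) (proj₁ y) p → Upward (proj₁ x') (proj₁ y') p' →
    SamePair (x , y) (x' , y') → x ≡ x' × y ≡ y' × p ≈ p'
  upward-unique (D , _) (D' , _) (inj₁ (refl , refl)) = refl , refl , Diff-position D D'
  upward-unique {x} {y} {p = p} {p'} (D , y-p) (D' , y'-p') (inj₂ (refl , refl)) = ⊥-elim (BoolP.not-¬ refl (begin
    true                  ≡⟨ y-p ⟨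
    at (proj₁ y) p        ≡⟨ flipped D ⟩
    not (at (proj₁ x) p)  ≡⟨ cong not (trans (at-cong (proj₁ x) (Diff-position D (Diff-sym {proj₁ y} D'))) y'-p') ⟩
    not true              ∎))
    where open ≡-Reasoning

  shift-determined : ∀ {c a a'} → Sign c → preimage a c 0 ≈ preimage a' c 0 → a ≈ a'
  shift-determined s r = sign-cancel minus (sign-cancel s r)

  record DihedralImage (w : Vec Bool n) (rw : Rooted w) (e : Edge n) : Set where
    constructor image
    field
      {c} : ℕ
      sign : Sign c
      shift : ℕ
      same : dihedralE sign shift (rootedEdge w rw) ≈E e

  orbit⇒image : ∀ w rw e → InOrbit (rootedEdge w rw) e → DihedralImage w rw e
  orbit⇒image w rw e (g , s) =
    image sign shift (subst₂ (λ a b → SamePair (a , b) (proj₁ e)) (acts-as (bottom w rw)) (acts-as (top w rw)) s)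
    where open IsDihedral (classification g)

  mirror : Vec Bool n → Vec Bool n
  mirror w = dihedral 0 N w

  mirror-rooted : ∀ w → Rooted w → Rooted (mirror w)
  mirror-rooted w rw = rooted (dihedral-lucas minus 0 w (lucas-w rw)) (trans (at-dihedral 0 N w 0) (trans (cong (at w) (*-zeroʳ N)) (root rw)))

  mirror-bottom : ∀ w → dihedral 0 N (toggle w 0) ≡ toggle (mirror w) 0
  mirror-bottom w = trans (Diff⇒toggle {mirror w} (Diff-sym {dihedral 0 N (toggle w 0)} (dihedral-Diff minus 0 (Diff-sym {w} (Diff-toggle w 0)))))
                          (toggle-cong (mirror w) (≡⇒≈ (trans (cong (N *_) (*-zeroʳ N)) (*-zeroʳ N))))

  mirror-in-orbit : ∀ w rw → InOrbit (rootedEdge w rw) (rootedEdge (mirror w) (mirror-rooted w rw))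
  mirror-in-orbit w rw = dihedralAut minus 0 , inj₁ (vertex-≡ (mirror-bottom w) , vertex-≡ refl)

  dihedral-shift-cong : ∀ {a a'} c u → a ≈ a' → dihedral a c u ≡ dihedral a' c u
  dihedral-shift-cong {a} {a'} c u r =
    at-ext _ _ (λ i → trans (at-dihedral a c u i) (trans (at-cong u (+-cong r (≈-refl {c * i}))) (sym (at-dihedral a' c u i))))

  dihedral-identity : ∀ u → dihedral 0 1 u ≡ u
  dihedral-identity u = at-ext _ _ (λ i → trans (at-dihedral 0 1 u i) (cong (at u) (*-identityˡ i)))

  rooted-orbit : ∀ w rw w' rw' → InOrbit (rootedEdge w rw) (rootedEdge w' rw') → w' ≡ w ⊎ w' ≡ mirror w
  rooted-orbit w rw w' rw' o = from-image (orbit⇒image w rw (rootedEdge w' rw') o)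
    where
    from-image : DihedralImage w rw (rootedEdge w' rw') → w' ≡ w ⊎ w' ≡ mirror w
    from-image (image {c} s a same) = by-sign s
      where
      ends : dihedralV s a (bottom w rw) ≡ bottom w' rw' × dihedralV s a (top w rw) ≡ top w' rw' × preimage a c 0 ≈ 0
      ends = upward-unique {dihedralV s a (bottom w rw)} {dihedralV s a (top w rw)} {bottom w' rw'} {top w' rw'}
               (upward-dihedral s a (upward-rooted w rw)) (upward-rooted w' rw') same
      tops : dihedral a c w ≡ w'
      tops = cong proj₁ (proj₁ (proj₂ ends))
      a≈0 : a ≈ 0
      a≈0 = shift-determined s (≈-trans (proj₂ (proj₂ ends)) (≡⇒≈ (sym (trans (cong (c *_) (*-zeroʳ N)) (*-zeroʳ c)))))
      by-sign : Sign c → w' ≡ w ⊎ w' ≡ mirror w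
      by-sign plus = inj₁ (trans (sym tops) (trans (dihedral-shift-cong 1 w a≈0) (dihedral-identity w)))
      by-sign minus = inj₂ (trans (sym tops) (dihedral-shift-cong N w a≈0))

  -- Every edge lies in the orbit of a rooted edge: rotate its upper
  -- endpoint so that the changed position becomes 0.
  record RootedRep (e : Edge n) : Set where
    constructor rep
    field
      {w} : Vec Bool n
      rw : Rooted w
      in-orbit : InOrbit (rootedEdge w rw) e

  rotate-to-root : ∀ (X Y : V n) p → Diff (proj₁ Y) (proj₁ X) p → at (proj₁ X) p ≡ true →
    Σ (Vec Bool n) λ w → Σ (Rooted w) λ rw → Σ (Aut n) λ g → act g (bottom w rw) ≡ Y × act g (top w rw) ≡ X
  rotate-to-root X Y p D X-p = w , rw , dihedralAut plus back , vertex-≡ bottom-back , vertex-≡ (dihedral-inverseˡ plus p x)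
    where
    x : Vec Bool n
    x = proj₁ X
    w : Vec Bool n
    w = dihedral p 1 x
    rw : Rooted w
    rw = rooted (dihedral-lucas plus p x (lucas X))
                (trans (at-dihedral p 1 x 0) (trans (cong (λ z → at x (p + z)) (*-zeroʳ 1)) (trans (cong (at x) (+-identityʳ p)) X-p)))
    back : ℕ
    back = inverse-shift p 1
    root↦p : preimage back 1 0 ≈ p
    root↦p = +-cancelˡ (N * p) (begin
      N * p + preimage back 1 0          ≡⟨ cong₂ _+_ (*-identityˡ (N * p)) (*-identityˡ (preimage back 1 0)) ⟨
      back + 1 * preimage back 1 0       ≈⟨ preimage-correct plus back 0 ⟩
      0                                  ≈⟨ ≈-sym (+-inverse p) ⟩
      p + N * p                          ≡⟨ +-comm p (N * p) ⟩
      N * p + p                          ∎)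
      where open ≈-Reasoning
    bottom-back : dihedral back 1 (toggle w 0) ≡ proj₁ Y
    bottom-back = begin
      dihedral back 1 (toggle w 0)       ≡⟨ Diff⇒toggle {dihedral back 1 w} (Diff-cong {dihedral back 1 w} root↦p
                                              (Diff-sym {dihedral back 1 (toggle w 0)} (dihedral-Diff plus back (Diff-sym {w} (Diff-toggle w 0))))) ⟩
      toggle (dihedral back 1 w) p       ≡⟨ cong (λ z → toggle z p) (dihedral-inverseˡ plus p x) ⟩
      toggle x p                         ≡⟨ Diff⇒toggle {x} (Diff-sym {proj₁ Y} D) ⟨
      proj₁ Y                            ∎
      where open ≡-Reasoning

  rootedRep : ∀ (e : Edge n) → RootedRep e
  rootedRep ((x , y) , h) with Adj⇒Diff x y h
  ... | p , _ , D with at (proj₁ y) p in y-p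
  ... | true = let (w , rw , g , b , t) = rotate-to-root y x p D y-p in rep rw (g , inj₁ (b , t))
  ... | false = let (w , rw , g , b , t) = rotate-to-root x y p (Diff-sym {proj₁ x} D) x-p in rep rw (g , inj₂ (b , t))
    where
    x-p : at (proj₁ x) p ≡ true
    x-p = trans (sym (BoolP.not-involutive (at (proj₁ x) p))) (trans (cong not (sym (flipped D))) (cong not y-p))

  module Images (w : Vec Bool n) (rw : Rooted w) where
    R : Edge n
    R = rootedEdge w rw

    images-equal : ∀ {c c'} (s : Sign c) (s' : Sign c') a a' → dihedralE s a R ≈E dihedralE s' a' R →
      dihedral a c w ≡ dihedral a' c' w × preimage a c 0 ≈ preimage a' c' 0
    images-equal s s' a a' same =
      let (_ , tops , roots) = upward-unique {dihedralV s a (bottom w rw)} {dihedralV s a (top w rw)}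
                                 {dihedralV s' a' (bottom w rw)} {dihedralV s' a' (top w rw)}
                                 (upward-dihedral s a (upward-rooted w rw)) (upward-dihedral s' a' (upward-rooted w rw)) same
      in cong proj₁ tops , roots

    same-sign : ∀ {c} (s : Sign c) a a' → dihedralE s a R ≈E dihedralE s a' R → a ≈ a'
    same-sign s a a' same = shift-determined s (proj₂ (images-equal s s a a' same))

    opposite-signs : ∀ a a' → dihedralE plus a R ≈E dihedralE minus a' R → mirror w ≡ w
    opposite-signs a a' same = at-ext _ _ (λ j → sym (trans (reflect j) (sym (at-dihedral 0 N w j))))
      where
      tops : dihedral a 1 w ≡ dihedral a' N w
      tops = proj₁ (images-equal plus minus a a' same)
      N*a≈a' : N * a ≈ a'
      N*a≈a' = ≈-trans (≡⇒≈ (sym (*-identityˡ (N * a))))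
                 (≈-trans (proj₂ (images-equal plus minus a a' same)) (≈-trans (≡⇒≈ (sym (*-assoc N N a'))) (sign²· minus a')))
      -- position j of w is position i of the first image and -j of the second
      i : ℕ → ℕ
      i j = j + N * a
      lhs : ∀ j → a + 1 * i j ≈ j
      lhs j = ≈-trans (≡⇒≈ (regroup a j N)) (≈-trans (+-cong (≈-refl {j}) (+-inverse a)) (≡⇒≈ (+-identityʳ j)))
        where
        regroup : ∀ a j N → a + 1 * (j + N * a) ≡ j + (a + N * a)
        regroup = solve-∀
      rhs : ∀ j → a' + N * i j ≈ N * j
      rhs j = begin
        a' + N * (j + N * a)          ≡⟨ expand a' j N a ⟩
        a' + N * j + N * N * a        ≈⟨ +-cong (+-cong (≈-sym N*a≈a') (≈-refl {N * j})) (sign²· minus a) ⟩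
        N * a + N * j + a             ≡⟨ regroup (N * a) (N * j) a ⟩
        N * j + (a + N * a)           ≈⟨ +-cong (≈-refl {N * j}) (+-inverse a) ⟩
        N * j + 0                     ≡⟨ +-identityʳ (N * j) ⟩
        N * j                         ∎
        where
        open ≈-Reasoning
        expand : ∀ a' j N a → a' + N * (j + N * a) ≡ (a' + N * j) + (N * N) * a
        expand = solve-∀
        regroup : ∀ x y a → (x + y) + a ≡ y + (a + x)
        regroup = solve-∀
      reflect : ∀ j → at w j ≡ at w (0 + N * j)
      reflect j = begin
        at w j                     ≡⟨ at-cong w (≈-sym (lhs j)) ⟩
        at w (a + 1 * i j)         ≡⟨ at-dihedral a 1 w (i j) ⟨
        at (dihedral a 1 w) (i j)  ≡⟨ cong (λ z → at z (i j)) tops ⟩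
        at (dihedral a' N w) (i j) ≡⟨ at-dihedral a' N w (i j) ⟩
        at w (a' + N * i j)        ≡⟨ at-cong w (rhs j) ⟩
        at w (N * j)               ∎
        where open ≡-Reasoning

    image-shift-cong : ∀ {c} (s : Sign c) {a a'} → a ≈ a' → dihedralE s a R ≈E dihedralE s a' R
    image-shift-cong s r = inj₁ (vertex-≡ (dihedral-shift-cong _ (toggle w 0) r) , vertex-≡ (dihedral-shift-cong _ w r))

    mirror-fixed-swap : ∀ u → mirror u ≡ u → ∀ a → dihedral a N u ≡ dihedral (N * a) 1 u
    mirror-fixed-swap u sym-u a = at-ext _ _ λ i → begin
      at (dihedral a N u) i                  ≡⟨ at-dihedral a N u i ⟩
      at u (a + N * i)                       ≡⟨ cong (λ z → at z (a + N * i)) sym-u ⟨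
      at (mirror u) (a + N * i)              ≡⟨ at-dihedral 0 N u (a + N * i) ⟩
      at u (N * (a + N * i))                 ≡⟨ at-cong u (shifted i) ⟩
      at u (N * a + 1 * i)                   ≡⟨ at-dihedral (N * a) 1 u i ⟨
      at (dihedral (N * a) 1 u) i            ∎
      where
      open ≡-Reasoning
      expand : ∀ N a i → N * (a + N * i) ≡ N * a + (N * N) * i
      expand = solve-∀
      shifted : ∀ i → N * (a + N * i) ≈ N * a + 1 * i
      shifted i = ≈-trans (≡⇒≈ (expand N a i)) (+-cong (≈-refl {N * a}) (≈-trans (sign²· minus i) (≡⇒≈ (sym (*-identityˡ i)))))

    index : ℕ → Fin n
    index a = a mod n

    index≈ : ∀ a → toℕ (index a) ≈ a
    index≈ a = ≈-trans (≡⇒≈ (FinP.toℕ-fromℕ< (m%n<n a n))) (%≈ a)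

    symmetric-orbit-size : mirror w ≡ w → OrbitSize R n
    symmetric-orbit-size sym-w = f , f-injective , (λ i → dihedral-in-orbit plus (toℕ i) R) , f-onto
      where
      f : Fin n → Edge n
      f i = dihedralE plus (toℕ i) R
      f-injective : ∀ i j → f i ≈E f j → i ≡ j
      f-injective i j h = FinP.toℕ-injective (<n⇒≡ (FinP.toℕ<n i) (FinP.toℕ<n j) (same-sign plus _ _ h))
      from-image : ∀ e → DihedralImage w rw e → ∃ λ i → f i ≈E e
      from-image e (image plus a same) = index a , SamePair-trans (image-shift-cong plus (index≈ a)) same
      from-image e (image minus a same) = index (N * a) , SamePair-trans swapped same
        where
        swapped : f (index (N * a)) ≈E dihedralE minus a R
        swapped = SamePair-trans (image-shift-cong plus (index≈ (N * a)))
          (inj₁ (vertex-≡ (sym (mirror-fixed-swap (toggle w 0) (trans (mirror-bottom w) (cong (λ z → toggle z 0) sym-w)) a)) ,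
                 vertex-≡ (sym (mirror-fixed-swap w sym-w a))))
      f-onto : ∀ e → InOrbit R e → ∃ λ i → f i ≈E e
      f-onto e o = from-image e (orbit⇒image w rw e o)

    asymmetric-orbit-size : ¬ (mirror w ≡ w) → OrbitSize R (2 * n)
    asymmetric-orbit-size asym = OrbitSize-⊎ {e = R} f f-injective in-orbit f-onto
      where
      n≡n+0 : n ≡ n + 0
      n≡n+0 = sym (+-identityʳ n)
      f : Fin n ⊎ Fin (n + 0) → Edge n
      f (inj₁ i) = dihedralE plus (toℕ i) R
      f (inj₂ i) = dihedralE minus (toℕ i) R
      <n : ∀ (i : Fin (n + 0)) → toℕ i < n
      <n i = subst (toℕ i <_) (sym n≡n+0) (FinP.toℕ<n i)
      f-injective : ∀ x y → f x ≈E f y → x ≡ y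
      f-injective (inj₁ i) (inj₁ j) h = cong inj₁ (FinP.toℕ-injective (<n⇒≡ (FinP.toℕ<n i) (FinP.toℕ<n j) (same-sign plus _ _ h)))
      f-injective (inj₂ i) (inj₂ j) h = cong inj₂ (FinP.toℕ-injective (<n⇒≡ (<n i) (<n j) (same-sign minus _ _ h)))
      f-injective (inj₁ i) (inj₂ j) h = ⊥-elim (asym (opposite-signs _ _ h))
      f-injective (inj₂ i) (inj₁ j) h = ⊥-elim (asym (opposite-signs _ _ (≈E-sym {e = f (inj₂ i)} {e' = f (inj₁ j)} h)))
      in-orbit : ∀ x → InOrbit R (f x)
      in-orbit (inj₁ i) = dihedral-in-orbit plus (toℕ i) R
      in-orbit (inj₂ i) = dihedral-in-orbit minus (toℕ i) R
      index⁻ : ℕ → Fin (n + 0)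
      index⁻ a = fromℕ< (subst (a % n <_) n≡n+0 (m%n<n a n))
      index⁻≈ : ∀ a → toℕ (index⁻ a) ≈ a
      index⁻≈ a = ≈-trans (≡⇒≈ (FinP.toℕ-fromℕ< _)) (%≈ a)
      from-image : ∀ e → DihedralImage w rw e → ∃ λ x → f x ≈E e
      from-image e (image plus a same) = inj₁ (index a) , SamePair-trans (image-shift-cong plus (index≈ a)) same
      from-image e (image minus a same) = inj₂ (index⁻ a) , SamePair-trans (image-shift-cong minus (index⁻≈ a)) same
      f-onto : ∀ e → InOrbit R e → ∃ λ x → f x ≈E e
      f-onto e o = from-image e (orbit⇒image w rw e o)

  open Images using (symmetric-orbit-size; asymmetric-orbit-size)

  n≢2n : n ≢ 2 * n
  n≢2n e = <-irrefl e (m<m+n n {n + 0} (s≤s z≤n))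

  mirror? : (w : Vec Bool n) → Dec (mirror w ≡ w)
  mirror? w = VecP.≡-dec BoolP._≟_ (mirror w) w

  size-n⇒symmetric : ∀ e w rw → InOrbit (rootedEdge w rw) e → OrbitSize e n → mirror w ≡ w
  size-n⇒symmetric e w rw o size = decide (mirror? w)
    where
    decide : Dec (mirror w ≡ w) → mirror w ≡ w
    decide (yes sym-w) = sym-w
    decide (no asym) = ⊥-elim (n≢2n (OrbitSize-unique {e = e} size
                         (OrbitSize-transfer {e₁ = rootedEdge w rw} {e₂ = e} o (asymmetric-orbit-size w rw asym))))

  size-2n⇒asymmetric : ∀ e w rw → InOrbit (rootedEdge w rw) e → OrbitSize e (2 * n) → ¬ (mirror w ≡ w)
  size-2n⇒asymmetric e w rw o size sym-w =
    n≢2n (OrbitSize-unique {e = e} (OrbitSize-transfer {e₁ = rootedEdge w rw} {e₂ = e} o (symmetric-orbit-size w rw sym-w)) size)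

  record SymmetricClasses : Set where
    field
      k : ℕ
      string : Fin k → Vec Bool n
      rooted-string : ∀ i → Rooted (string i)
      symmetric : ∀ i → mirror (string i) ≡ string i
      distinct : ∀ i j → string i ≡ string j → i ≡ j
      complete : ∀ w → Rooted w → mirror w ≡ w → ∃ λ i → string i ≡ w

  count-symmetric : (S : SymmetricClasses) → NumEdgeOrbitsOfSize n n (SymmetricClasses.k S)
  count-symmetric S = r , (λ i → symmetric-orbit-size (string i) (rooted-string i) (symmetric i)) , different , hit
    where
    open SymmetricClasses S
    r : Fin k → Edge n
    r i = rootedEdge (string i) (rooted-string i)
    different : ∀ i j → InOrbit (r i) (r j) → i ≡ j
    different i j o = from-strings (rooted-orbit (string i) (rooted-string i) (string j) (rooted-string j) o)
      where
      from-strings : string j ≡ string i ⊎ string j ≡ mirror (string i) → i ≡ j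
      from-strings (inj₁ same) = distinct i j (sym same)
      from-strings (inj₂ mirrored) = distinct i j (sym (trans mirrored (symmetric i)))
    hit : ∀ e → OrbitSize e n → ∃ λ i → InOrbit (r i) e
    hit e size = from-rep (rootedRep e)
      where
      from-rep : RootedRep e → ∃ λ i → InOrbit (r i) e
      from-rep (rep {w} rw o) = i , rootedEdge-irrelevant rw (rooted-string i) e (sym string-i≡w) o
        where
        found : ∃ λ i → string i ≡ w
        found = complete w rw (size-n⇒symmetric e w rw o size)
        i : Fin k
        i = proj₁ found
        string-i≡w : string i ≡ w
        string-i≡w = proj₂ found

  record AsymmetricClasses : Set where
    field
      k : ℕ
      string : Fin k → Vec Bool n
      rooted-string : ∀ i → Rooted (string i)
      asymmetric : ∀ i → ¬ (mirror (string i) ≡ string i)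
      distinct : ∀ i j → string i ≡ string j → i ≡ j
      no-mirror-pair : ∀ i j → string j ≡ mirror (string i) → ⊥
      complete : ∀ w → Rooted w → ¬ (mirror w ≡ w) → ∃ λ i → string i ≡ w ⊎ string i ≡ mirror w

  count-asymmetric : (S : AsymmetricClasses) → NumEdgeOrbitsOfSize n (2 * n) (AsymmetricClasses.k S)
  count-asymmetric S = r , (λ i → asymmetric-orbit-size (string i) (rooted-string i) (asymmetric i)) , different , hit
    where
    open AsymmetricClasses S
    r : Fin k → Edge n
    r i = rootedEdge (string i) (rooted-string i)
    different : ∀ i j → InOrbit (r i) (r j) → i ≡ j
    different i j o = from-strings (rooted-orbit (string i) (rooted-string i) (string j) (rooted-string j) o)
      where
      from-strings : string j ≡ string i ⊎ string j ≡ mirror (string i) → i ≡ j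
      from-strings (inj₁ same) = distinct i j (sym same)
      from-strings (inj₂ mirrored) = ⊥-elim (no-mirror-pair i j mirrored)
    hit : ∀ e → OrbitSize e (2 * n) → ∃ λ i → InOrbit (r i) e
    hit e size = from-rep (rootedRep e)
      where
      from-rep : RootedRep e → ∃ λ i → InOrbit (r i) e
      from-rep (rep {w} rw o) = from-class (complete w rw (size-2n⇒asymmetric e w rw o size))
        where
        mirror-o : InOrbit (rootedEdge (mirror w) (mirror-rooted w rw)) e
        mirror-o = InOrbit-trans {e₁ = rootedEdge (mirror w) (mirror-rooted w rw)} {e₂ = rootedEdge w rw} {e₃ = e}
          (InOrbit-sym {e₁ = rootedEdge w rw} {e₂ = rootedEdge (mirror w) (mirror-rooted w rw)} (mirror-in-orbit w rw)) o
        from-class : (∃ λ i → string i ≡ w ⊎ string i ≡ mirror w) → ∃ λ i → InOrbit (r i) e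
        from-class (i , inj₁ string-i≡w) = i , rootedEdge-irrelevant rw (rooted-string i) e (sym string-i≡w) o
        from-class (i , inj₂ string-i≡mirror) = i , rootedEdge-irrelevant (mirror-rooted w rw) (rooted-string i) e (sym string-i≡mirror) mirror-o

module Mirror (N : ℕ) where
  open Cyclic N

  dihedral-0N : ∀ (a : Bool) (t : Vec Bool N) → dihedral 0 N (a ∷ t) ≡ a ∷ reverse t
  dihedral-0N a t = at-ext _ _ (λ i → trans (at-dihedral 0 N (a ∷ t) i) (sym (letters i)))
    where
    letters : ∀ i → at (a ∷ reverse t) i ≡ at (a ∷ t) (0 + N * i)
    letters i = trans (at≡bit (a ∷ reverse t) i) (by-residue (i % n) (m%n<n i n) (%≈ i))
      where
      by-residue : ∀ r → r < n → r ≈ i → bit (a ∷ reverse t) r ≡ at (a ∷ t) (0 + N * i)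
      by-residue zero _ 0≈i = sym (trans (at-cong (a ∷ t) (≈-trans (*-cong (≈-refl {N}) (≈-sym 0≈i)) (≡⇒≈ (*-zeroʳ N))))
                                         (at≡bit< (a ∷ t) (s≤s z≤n)))
      by-residue (suc k) (s≤s k<N) 1+k≈i = trans (bit-reverse t k k<N)
        (sym (trans (at-cong (a ∷ t) position) (trans (at≡bit< (a ∷ t) (s≤s (m∸n≤m N k))) (cong (bit (a ∷ t)) (∸-suc N k k<N)))))
        where
        position : 0 + N * i ≈ N ∸ k
        position = +-cancelˡ (suc k) (≈-trans (+-cong (≈-refl {suc k}) (*-cong (≈-refl {N}) (≈-sym 1+k≈i)))
          (≈-trans (+-inverse (suc k)) (≈-sym (≈-trans (≡⇒≈ (cong suc (m+[n∸m]≡n (<⇒≤ k<N)))) n≈0))))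

module Counting (m : ℕ) where
  N : ℕ
  N = suc (suc m)

  open Cyclic N
  open Mirror N
  open EdgeOrbits N (s≤s z≤n)

  rootedOf : Vec Bool m → Vec Bool n
  rootedOf s = true ∷ false ∷ (s ∷ʳ false)

  rootedOf-injective : ∀ {s s'} → rootedOf s ≡ rootedOf s' → s ≡ s'
  rootedOf-injective {s} {s'} e = VecP.∷ʳ-injectiveˡ s s' (proj₂ (VecP.∷-injective (proj₂ (VecP.∷-injective e))))

  isLucas-10 : ∀ (s : Vec Bool m) c → isLucas (true ∷ false ∷ (s ∷ʳ c)) ≡ noConsec s ∧ not c
  isLucas-10 s c = begin
    noConsec (false ∷ (s ∷ʳ c)) ∧ not (lastB (true ∷ false ∷ (s ∷ʳ c)))
      ≡⟨ cong₂ (λ a b → a ∧ not b) (noConsec-false∷ (s ∷ʳ c)) (lastB-∷ʳ (true ∷ false ∷ s) c) ⟩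
    noConsec (s ∷ʳ c) ∧ not c   ≡⟨ last-letter c ⟩
    noConsec s ∧ not c          ∎
    where
    open ≡-Reasoning
    last-letter : ∀ c → noConsec (s ∷ʳ c) ∧ not c ≡ noConsec s ∧ not c
    last-letter false = cong (_∧ true) (noConsec-∷ʳ-false s)
    last-letter true = trans (BoolP.∧-zeroʳ _) (sym (BoolP.∧-zeroʳ _))

  rootedOf-rooted : ∀ s → T (noConsec s) → Rooted (rootedOf s)
  rootedOf-rooted s t = rooted (isLucas⇒cyclic (rootedOf s) lucas-s) (at≡bit< (rootedOf s) (s≤s z≤n))
    where
    lucas-s : T (isLucas (rootedOf s))
    lucas-s = subst T (sym (trans (isLucas-10 s false) (BoolP.∧-identityʳ (noConsec s)))) t

  mirror-rootedOf : ∀ s → mirror (rootedOf s) ≡ rootedOf (reverse s)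
  mirror-rootedOf s = trans (dihedral-0N true (false ∷ (s ∷ʳ false))) (cong (true ∷_) (reverse-wrap false s))

  rooted⇒rootedOf : ∀ w → Rooted w → Σ (Vec Bool m) λ s → T (noConsec s) × w ≡ rootedOf s
  rooted⇒rootedOf (a ∷ b ∷ r) rw with initLast r
  ... | s , c , refl = shape a b c (trans (sym (at≡bit< (a ∷ b ∷ (s ∷ʳ c)) (s≤s z≤n))) (root rw)) (cyclic⇒isLucas _ (lucas-w rw))
    where
    shape : ∀ a b c → a ≡ true → T (isLucas (a ∷ b ∷ (s ∷ʳ c))) →
      Σ (Vec Bool m) λ s' → T (noConsec s') × a ∷ b ∷ (s ∷ʳ c) ≡ rootedOf s'
    shape true true c refl ()
    shape true false c refl t with Equivalence.to (BoolP.T-∧ {noConsec s}) (subst T (isLucas-10 s c) t)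
    ... | nc , last with c
    ...   | false = s , nc , refl

  open NonPalindromes m
    using (below; below-unique; below-sound; below-complete; IsBelow; reverse-fibonacci; reverse-non-palindrome; length-below)

  symmetric⇒palindrome : ∀ s → mirror (rootedOf s) ≡ rootedOf s → Palindrome s
  symmetric⇒palindrome s sym-s = rootedOf-injective (trans (sym (mirror-rootedOf s)) sym-s)

  asymmetric⇒non-palindrome : ∀ s → ¬ (mirror (rootedOf s) ≡ rootedOf s) → ¬ Palindrome s
  asymmetric⇒non-palindrome s asym pal = asym (trans (mirror-rootedOf s) (cong rootedOf pal))

  symmetricClasses : SymmetricClasses
  symmetricClasses = record
    { k = length (palindromes m)
    ; string = λ i → rootedOf (pal i)
    ; rooted-string = λ i → rootedOf-rooted _ (proj₁ (palindromes-sound m _ (∈-lookup i)))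
    ; symmetric = λ i → trans (mirror-rootedOf _) (cong rootedOf (proj₂ (palindromes-sound m _ (∈-lookup i))))
    ; distinct = λ i j e → lookup-injective (palindromes-unique m) i j (rootedOf-injective e)
    ; complete = complete }
    where
    pal : Fin (length (palindromes m)) → Vec Bool m
    pal = List.lookup (palindromes m)
    complete : ∀ w → Rooted w → mirror w ≡ w → ∃ λ i → rootedOf (pal i) ≡ w
    complete w rw sym-w with rooted⇒rootedOf w rw
    ... | s , nc , refl = Any.index s∈ , cong rootedOf (sym (lookup-index s∈))
      where
      s∈ : s ∈ palindromes m
      s∈ = palindromes-complete m s nc (symmetric⇒palindrome s sym-w)

  low : Fin (length below) → Vec Bool m
  low = List.lookup below

  low-is-below : ∀ i → IsBelow (low i)
  low-is-below i = below-sound (low i) (∈-lookup i)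

  low-no-mirror-pair : ∀ i j → rootedOf (low j) ≡ mirror (rootedOf (low i)) → ⊥
  low-no-mirror-pair i j e = BoolP.not-¬ refl (begin
    false                             ≡⟨ <lex-asym sᵢ (reverse sᵢ) (IsBelow.is-below (low-is-below i)) ⟨
    reverse sᵢ <lex sᵢ                ≡⟨ cong₂ _<lex_ (sym sⱼ≡rev) (trans (sym (VecP.reverse-involutive sᵢ)) (cong reverse (sym sⱼ≡rev))) ⟩
    sⱼ <lex reverse sⱼ                ≡⟨ IsBelow.is-below (low-is-below j) ⟩
    true                              ∎)
    where
    open ≡-Reasoning
    sᵢ sⱼ : Vec Bool m
    sᵢ = low i
    sⱼ = low j
    sⱼ≡rev : sⱼ ≡ reverse sᵢ
    sⱼ≡rev = rootedOf-injective (trans e (mirror-rootedOf sᵢ))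

  low-complete : ∀ s → T (noConsec s) → ¬ Palindrome s →
    ∃ λ i → rootedOf (low i) ≡ rootedOf s ⊎ rootedOf (low i) ≡ mirror (rootedOf s)
  low-complete s nc non-pal = choose (<lex-connex s (reverse s) (λ e → non-pal (sym e)))
    where
    choose : s <lex reverse s ≡ true ⊎ reverse s <lex s ≡ true →
      ∃ λ i → rootedOf (low i) ≡ rootedOf s ⊎ rootedOf (low i) ≡ mirror (rootedOf s)
    choose (inj₁ s-below) = Any.index s∈ , inj₁ (cong rootedOf (sym (lookup-index s∈)))
      where
      s∈ : s ∈ below
      s∈ = below-complete s nc non-pal s-below
    choose (inj₂ s-above) = Any.index s∈ , inj₂ (trans (cong rootedOf (sym (lookup-index s∈))) (sym (mirror-rootedOf s)))
      where
      s∈ : reverse s ∈ below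
      s∈ = below-complete (reverse s) (reverse-fibonacci s nc) (reverse-non-palindrome s non-pal)
             (trans (cong (reverse s <lex_) (VecP.reverse-involutive s)) s-above)

  asymmetricClasses : AsymmetricClasses
  asymmetricClasses = record
    { k = length below
    ; string = λ i → rootedOf (low i)
    ; rooted-string = λ i → rootedOf-rooted _ (IsBelow.fibonacci (low-is-below i))
    ; asymmetric = λ i e → IsBelow.not-palindrome (low-is-below i) (symmetric⇒palindrome (low i) e)
    ; distinct = λ i j e → lookup-injective below-unique i j (rootedOf-injective e)
    ; no-mirror-pair = low-no-mirror-pair
    ; complete = complete }
    where
    complete : ∀ w → Rooted w → ¬ (mirror w ≡ w) → ∃ λ i → rootedOf (low i) ≡ w ⊎ rootedOf (low i) ≡ mirror w
    complete w rw asym with rooted⇒rootedOf w rw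
    ... | s , nc , refl = low-complete s nc (asymmetric⇒non-palindrome s asym)

  orbits-of-size-n : NumEdgeOrbitsOfSize n n (F (idx n))
  orbits-of-size-n = subst (NumEdgeOrbitsOfSize n n) (length-palindromes m) (count-symmetric symmetricClasses)

  orbits-of-size-2n : NumEdgeOrbitsOfSize n (2 * n) ((F (n ∸ 1) ∸ F (idx n)) / 2)
  orbits-of-size-2n = subst (NumEdgeOrbitsOfSize n (2 * n)) length-below (count-asymmetric asymmetricClasses)

no-edges-Λ₁ : Edge 1 → ⊥
no-edges-Λ₁ (((false ∷ [] , _) , (false ∷ [] , _)) , ())
no-edges-Λ₁ (((true ∷ [] , ()) , _) , _)
no-edges-Λ₁ (((false ∷ [] , _) , (true ∷ [] , ())) , _)

no-orbits-Λ₁ : ∀ k → NumEdgeOrbitsOfSize 1 k 0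
no-orbits-Λ₁ k = (λ ()) , (λ ()) , (λ ()) , λ e _ → ⊥-elim (no-edges-Λ₁ e)

module Λ₂ where
  open Cyclic 1
  open Mirror 1
  open EdgeOrbits 1 (s≤s z≤n)

  w₀ : Vec Bool 2
  w₀ = true ∷ false ∷ []

  w₀-symmetric : mirror w₀ ≡ w₀
  w₀-symmetric = dihedral-0N true (false ∷ [])

  only-rooted : ∀ w → Rooted w → w ≡ w₀
  only-rooted (a ∷ b ∷ []) rw = shape a b (trans (sym (at≡bit< (a ∷ b ∷ []) (s≤s z≤n))) (root rw)) (cyclic⇒isLucas _ (lucas-w rw))
    where
    shape : ∀ a b → a ≡ true → T (isLucas (a ∷ b ∷ [])) → a ∷ b ∷ [] ≡ w₀
    shape true false refl _ = refl
    shape true true refl ()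

  orbits : NumEdgeOrbitsOfSize 2 2 1 × NumEdgeOrbitsOfSize 2 4 0
  orbits = count-symmetric (record
             { k = 1 ; string = λ _ → w₀
             ; rooted-string = λ _ → rooted (isLucas⇒cyclic w₀ tt) (at≡bit< w₀ (s≤s z≤n))
             ; symmetric = λ _ → w₀-symmetric
             ; distinct = λ { Fin.zero Fin.zero _ → refl }
             ; complete = λ w rw _ → Fin.zero , sym (only-rooted w rw) }) ,
           count-asymmetric (record
             { k = 0 ; string = λ () ; rooted-string = λ () ; asymmetric = λ () ; distinct = λ () ; no-mirror-pair = λ ()
             ; complete = λ w rw asym → ⊥-elim (asym (trans (cong mirror (only-rooted w rw)) (trans w₀-symmetric (sym (only-rooted w rw))))) })

corollary5p11 : (n : ℕ) → 1 ≤ n →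
    NumEdgeOrbitsOfSize n n (F (idx n)) ×
    NumEdgeOrbitsOfSize n (2 * n) ((F (n ∸ 1) ∸ F (idx n)) / 2)
corollary5p11 (suc zero) _ = no-orbits-Λ₁ 1 , no-orbits-Λ₁ 2
corollary5p11 (suc (suc zero)) _ = Λ₂.orbits
corollary5p11 (suc (suc (suc m))) _ = Counting.orbits-of-size-n m , Counting.orbits-of-size-2n m
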